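{- Let $\Gamma=(V,E)$ be a finite simple graph and let $G$ be a finite group acting on $\Gamma$ by automorphisms. Then $G$ acts on $\mathrm{Col}_n(\Gamma)$ and for all integers $n\ge1$, \[ \chi_{\Gamma,G}(n)=\frac{1}{|G|}\sum_{g\in G}\sum_{\sigma\in\Sigma^g}\Omega^{\circ}_{\Gamma^{\sigma}_g}(n). \] In particular, $\chi_{\Gamma,G}(n)$ agrees with a polynomial of degree $|\Gamma|=|V|$ for all $n\ge1$.
   Context: $G$ acts on $\Gamma$ by automorphisms: it acts on $V$ and $uv\in E$ implies $(g\cdot u)(g\cdot v)\in E$. An $n$-coloring is a map $c\colon V\to[n]=\{1,\dots,n\}$; it is proper if $c(u)\ne c(v)$ for every edge $uv$. $\mathrm{Col}_n(\Gamma)$ is the set of proper $n$-colorings, with $G$-action $(g\cdot c)(v)=c(g^{ -1}v)$, and $\chi_{\Gamma,G}(n)$ is the number of $G$-orbits of $\mathrm{Col}_n(\Gamma)$. An orientation $\sigma\colon E\to V$ assigns to each edge one of its endpoints (its head); it is acyclic if there is no directed cycle. $\Sigma$ is the set of acyclic orientations, with $G$-action $(g\cdot\sigma)(uv)=g\cdot\sigma(g^{ -1}\cdot uv)$, and $\Sigma^g$ the set of those fixed by $g$. An acyclic orientation $\sigma$ gives a poset $\Gamma^\sigma$ on $V$ with $v\prec_\sigma w$ iff there is a directed path from $v$ to $w$. For $\sigma\in\Sigma^g$, $g$ acts on $\Gamma^\sigma$ by automorphisms and $\Gamma^\sigma_g$ denotes the quotient poset on the orbits $[x]_g$ of $\langle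 g\rangle$ on $V$, with $[x]_g\prec[y]_g$ iff there exist $\tilde x\in[x]_g$, $\tilde y\in[y]_g$ with $\tilde x\prec_\sigma\tilde y$. For a finite poset $Q$, $\Omega^\circ_Q(n)$ is the number of strictly order preserving maps $Q\to[n]$ (maps with $\phi(p)<\phi(q)$ whenever $p\prec q$). -}

module Defs where

open import Level using (0ℓ)
open import Data.Nat using (ℕ; zero; suc; _≤_)
open import Data.Bool using (Bool; true; false)
open import Data.Fin using (Fin; toℕ; fromℕ) renaming (_<_ to _<ᶠ_)
open import Data.Product using (Σ; ∃; _×_; _,_; proj₁)
open import Data.Sum using (_⊎_)
open import Data.Integer using (+_)
open import Data.Rational as ℚ using (ℚ; 0ℚ; 1ℚ)
open import Relation.Nullary using (¬_)
open import Relation.Binary.PropositionalEquality using (_≡_; _≢_)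
open import Algebra.Bundles using (Group)

-- Cardinality of a finite setoid: (A , ≈) has exactly k classes, i.e.
-- there is a map Fin k → A hitting every class exactly once.
-- With ≈ = "same G-orbit" this is the number of orbits.

record Card (A : Set) (_≈_ : A → A → Set) (k : ℕ) : Set where
  field
    enum : Fin k → A
    surj : (a : A) → ∃ λ i → enum i ≈ a
    inj  : (i j : Fin k) → enum i ≈ enum j → i ≡ j

record Graph : Set where
  field
    m       : ℕ
    adj     : Fin m → Fin m → Bool
    adj-sym : (u v : Fin m) → adj u v ≡ adj v u
    loopless : (u : Fin m) → adj u u ≡ false

∣_∣ᵥ : Graph → ℕ
∣ Γ ∣ᵥ = Graph.m Γ

record Action (G : Group 0ℓ 0ℓ) (Γ : Graph) : Set where
  open Group G
  open Graph Γ
  field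
    act       : Carrier → Fin m → Fin m
    act-resp  : (g h : Carrier) → g ≈ h → (v : Fin m) → act g v ≡ act h v
    act-ε     : (v : Fin m) → act ε v ≡ v
    act-∙     : (g h : Carrier) (v : Fin m) → act (g ∙ h) v ≡ act g (act h v)
    act-adj   : (g : Carrier) (u v : Fin m) →
                adj u v ≡ true → adj (act g u) (act g v) ≡ true

module _ {G : Group 0ℓ 0ℓ} {Γ : Graph} (A : Action G Γ) where
  open Group G
  open Graph Γ
  open Action A

  -- Colorings. The colour set [n] = {1,…,n} is represented by Fin n
  -- (order-isomorphic, values 0,…,n-1).

  Coloring : ℕ → Set
  Coloring n = Fin m → Fin n

  Proper : {n : ℕ} → Coloring n → Set
  Proper c = (u v : Fin m) → adj u v ≡ true → c u ≢ c v

  _·ᶜ_ : {n : ℕ} → Carrier → Coloring n → Coloring n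
  (g ·ᶜ c) v = c (act (g ⁻¹) v)

  Col : ℕ → Set
  Col n = Σ (Coloring n) Proper

  SameOrbit : {n : ℕ} → Col n → Col n → Set
  SameOrbit (c , _) (d , _) = ∃ λ g → (v : Fin m) → (g ·ᶜ c) v ≡ d v

  -- χ_{Γ,G}(n) = k : Col_n(Γ) has exactly k G-orbits
  OrbitCount : ℕ → ℕ → Set
  OrbitCount n k = Card (Col n) SameOrbit k

  -- An orientation σ : E → V (choice of a head for each
  -- edge) is encoded by its arc relation: arc u v = true iff uv ∈ E and
  -- σ(uv) = v.

  record Orientation : Set where
    field
      arc      : Fin m → Fin m → Bool
      arc-edge : (u v : Fin m) → arc u v ≡ true → adj u v ≡ true
      arc-tot  : (u v : Fin m) → adj u v ≡ true →
                 arc u v ≡ true ⊎ arc v u ≡ true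
      arc-asym : (u v : Fin m) → arc u v ≡ true → arc v u ≡ false
  open Orientation public

  _≈ᵒ_ : Orientation → Orientation → Set
  σ ≈ᵒ τ = (u v : Fin m) → arc σ u v ≡ arc τ u v

  data Path (σ : Orientation) : Fin m → Fin m → Set where
    edge : {u w : Fin m} → arc σ u w ≡ true → Path σ u w
    cons : {u v w : Fin m} → arc σ u v ≡ true → Path σ v w → Path σ u w

  Acyclic : Orientation → Set
  Acyclic σ = (v : Fin m) → ¬ Path σ v v

  -- (g · σ)(uv) = g · σ(g⁻¹ · uv), i.e. arc_{g·σ} u v = arc_σ (g⁻¹u) (g⁻¹v);
  -- σ ∈ Σ^g iff g · σ = σ
  Fixed : Carrier → Orientation → Set
  Fixed g σ = (u v : Fin m) →
              arc σ (act (g ⁻¹) u) (act (g ⁻¹) v) ≡ arc σ u v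

  -- Orbits [x]_g of ⟨g⟩ on V (G finite, so ⟨g⟩ = {gᵏ : k ∈ ℕ}).

  iter : (Fin m → Fin m) → ℕ → Fin m → Fin m
  iter f zero    x = x
  iter f (suc k) x = f (iter f k x)

  _∈[_]_ : Fin m → Fin m → Carrier → Set
  y ∈[ x ] g = ∃ λ k → y ≡ iter (act g) k x

  -- [x]_g ≺ [y]_g in the quotient poset Γ^σ_g
  QLess : Carrier → Orientation → Fin m → Fin m → Set
  QLess g σ x y = ∃ λ x̃ → ∃ λ ỹ → x̃ ∈[ x ] g × ỹ ∈[ y ] g × Path σ x̃ ỹ

  -- strictly order preserving maps Γ^σ_g → [n], represented as maps
  -- φ : V → [n] constant on ⟨g⟩-orbits
  StrictOP : (n : ℕ) → Carrier → Orientation → (Fin m → Fin n) → Set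
  StrictOP n g σ φ =
    ((x : Fin m) → φ (act g x) ≡ φ x) ×
    ((x y : Fin m) → QLess g σ x y → φ x <ᶠ φ y)

  -- Σ_{g ∈ G} Σ_{σ ∈ Σ^g} Ω°_{Γ^σ_g}(n) is the number of triples
  -- (g, σ, φ) with σ ∈ Σ^g and φ strictly order preserving Γ^σ_g → [n].

  Triple : ℕ → Set
  Triple n = Σ Carrier λ g → Σ Orientation λ σ →
             Acyclic σ × Fixed g σ × Σ (Fin m → Fin n) (StrictOP n g σ)

  _≈ᵗ_ : {n : ℕ} → Triple n → Triple n → Set
  (g , σ , _ , _ , φ , _) ≈ᵗ (h , τ , _ , _ , ψ , _) =
    g ≈ h × σ ≈ᵒ τ × ((x : Fin m) → φ x ≡ ψ x)

  TripleCount : ℕ → ℕ → Set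
  TripleCount n t = Card (Triple n) _≈ᵗ_ t

_^ℚ_ : ℚ → ℕ → ℚ
q ^ℚ zero  = 1ℚ
q ^ℚ suc k = q ℚ.* (q ^ℚ k)

evalPoly : (d : ℕ) → (Fin (suc d) → ℚ) → ℚ → ℚ
evalPoly zero    a x = a Fin.zero
  where import Data.Fin as Fin
evalPoly (suc d) a x =
  evalPoly d (λ i → a (Fin.inject₁ i)) x ℚ.+ a (fromℕ (suc d)) ℚ.* (x ^ℚ suc d)
  where import Data.Fin as Fin

ℕtoℚ : ℕ → ℚ
ℕtoℚ k = (+ k) ℚ./ 1

module Submission where

-- (1) Orbit–stabiliser (module OrbitCounting): a finite group acting on a
--     setoid with χ orbits has |G|·χ fixed pairs (g, x), g · x ≈ x.  For
--     colourings, a fixed pair (g, c) is the same as a triple (g, σ, φ) by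
--     Stanley's correspondence: σ directs each edge towards its larger
--     colour and φ = c (module Colourings).
-- (2) A colouring fixed by g factors uniquely as an "exact" g-invariant
--     colouring onto [k], k ≤ m, followed by an increasing map [k] → [n]
--     (module IncreasingMaps), so #Fix(g) = Σ_k #Exact(g,k) · (n C k).
--     By Burnside's lemma |G|·χ(n) = Σ_{k ≤ m} T_k (n C k) with T_m ≥ 1
--     (the identity colouring), and writing n C k as a polynomial in n
--     gives a rational polynomial of degree exactly m
--     (module BinomialPolynomials).

open import Defs
open import Level using (0ℓ)
open import Data.Nat using (ℕ; suc)
open import Data.Fin using (Fin; fromℕ)
open import Data.Product using (Σ; _×_)
open import Data.Rational using (ℚ; 0ℚ)
open import Relation.Binary.PropositionalEquality using (_≡_; _≢_; _≗_)
open import Algebra.Bundles using (Group; Ring)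
open import Function using (_∘_)
open import Relation.Binary using (Rel; IsEquivalence; Setoid)
import Relation.Binary.Reasoning.Setoid
import Algebra.Properties.Semiring.Sum
import Data.Nat.Properties

module ℕΣ = Algebra.Properties.Semiring.Sum Data.Nat.Properties.+-*-semiring

module Counting where

  open import Data.Nat as ℕ using (zero; _+_; _*_)
  import Data.Nat.Properties as ℕP
  open ℕΣ using (sum)
  open import Data.Fin as F using (splitAt; _↑ˡ_; _↑ʳ_; combine; remQuot)
  import Data.Fin.Properties as FP
  open import Data.Vec.Functional using () renaming (_∷_ to _◂_)
  open import Data.Product using (∃; _,_; proj₁; proj₂)
  open import Data.Sum using (_⊎_; inj₁; inj₂)
  open import Data.Sum.Relation.Binary.Pointwise as ⊎ᴾ using () renaming (Pointwise to ⊎-Pointwise)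
  open import Data.Product.Relation.Binary.Pointwise.NonDependent using () renaming (Pointwise to ×-Pointwise)
  open import Data.Maybe as Maybe using (Maybe)
  import Data.Maybe.Relation.Unary.Any as MAny
  open import Data.List using (List; []; _∷_; allFin; concatMap; mapMaybe)
  import Data.List as L
  open import Data.List.Relation.Unary.Any using (Any; here; there)
  import Data.List.Relation.Unary.Any as Any
  open import Data.List.Relation.Unary.Any.Properties using (mapMaybe⁺; concatMap⁺; map⁺)
  open import Data.List.Membership.Propositional.Properties using (∈-allFin)
  open import Data.Empty using (⊥-elim)
  open import Relation.Nullary using (Dec; yes; no)
  open import Relation.Nullary.Decidable using (dec⇒maybe)
  open import Relation.Unary using (Pred)
  open import Relation.Binary using (Transitive; Decidable)
  open import Relation.Binary.PropositionalEquality using (refl; cong; cong₂; subst)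
  import Relation.Binary.PropositionalEquality as ≡

  open Card

  Card-map : {A B : Set} {R : Rel A 0ℓ} {S : Rel B 0ℓ} {k : ℕ} → Transitive S →
    (f : A → B) → (∀ {a a'} → R a a' → S (f a) (f a')) →
    (∀ a a' → S (f a) (f a') → R a a') → (∀ b → ∃ λ a → S (f a) b) →
    Card A R k → Card B S k
  Card-map S-trans f f-resp f-refl f-surj C = record
    { enum = f ∘ enum C
    ; surj = λ b → let (a , fa∼b) = f-surj b ; (i , i∼a) = surj C a
                   in i , S-trans (f-resp i∼a) fa∼b
    ; inj  = λ i j e → inj C i j (f-refl _ _ e)
    }

  Card-unique : {A : Set} {R : Rel A 0ℓ} {k k' : ℕ} → IsEquivalence R →
    Card A R k → Card A R k' → k ≡ k'
  Card-unique {A} {R} R-equiv C D = ℕP.≤-antisym (≤-count C D) (≤-count D C)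
    where
    open IsEquivalence R-equiv using (sym; trans)
    -- sending each representative of C to the representative of D of
    -- its class is injective
    ≤-count : ∀ {a b} → Card A R a → Card A R b → a ℕ.≤ b
    ≤-count C D = FP.injective⇒≤ {f = λ i → proj₁ (surj D (enum C i))} λ {i} {j} e →
      inj C i j (trans (sym (proj₂ (surj D (enum C i))))
        (subst (λ t → R (enum D t) (enum C j)) (≡.sym e) (proj₂ (surj D (enum C j)))))

  Card-nonzero : {A : Set} {R : Rel A 0ℓ} {k : ℕ} → Card A R k → A → k ≢ 0
  Card-nonzero C a refl with surj C a
  ... | () , _

  Card-Fin : (k : ℕ) → Card (Fin k) _≡_ k
  Card-Fin k = record { enum = λ i → i ; surj = λ i → i , refl ; inj = λ i j e → e }

  Card-⊎ : {A B : Set} {R : Rel A 0ℓ} {S : Rel B 0ℓ} {a b : ℕ} →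
    Card A R a → Card B S b → Card (A ⊎ B) (⊎-Pointwise R S) (a + b)
  Card-⊎ {R = R} {S} {a} {b} C D = record { enum = enum⊎ ∘ splitAt a ; surj = surj⊎ ; inj = inj⊎ }
    where
    enum⊎ : Fin a ⊎ Fin b → _
    enum⊎ (inj₁ i) = inj₁ (enum C i)
    enum⊎ (inj₂ j) = inj₂ (enum D j)
    surj⊎ : ∀ z → ∃ λ x → ⊎-Pointwise R S (enum⊎ (splitAt a x)) z
    surj⊎ (inj₁ y) = let (i , p) = surj C y in
      i ↑ˡ b , subst (λ t → ⊎-Pointwise R S (enum⊎ t) (inj₁ y)) (≡.sym (FP.splitAt-↑ˡ a i b)) (⊎ᴾ.inj₁ p)
    surj⊎ (inj₂ y) = let (j , p) = surj D y in
      a ↑ʳ j , subst (λ t → ⊎-Pointwise R S (enum⊎ t) (inj₂ y)) (≡.sym (FP.splitAt-↑ʳ a b j)) (⊎ᴾ.inj₂ p)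
    inj⊎ : ∀ x y → ⊎-Pointwise R S (enum⊎ (splitAt a x)) (enum⊎ (splitAt a y)) → x ≡ y
    inj⊎ x y r with splitAt a x in ex | splitAt a y in ey | r
    ... | inj₁ i | inj₁ j | ⊎ᴾ.inj₁ p =
      ≡.trans (≡.sym (FP.splitAt⁻¹-↑ˡ ex)) (≡.trans (cong (_↑ˡ b) (inj C i j p)) (FP.splitAt⁻¹-↑ˡ ey))
    ... | inj₂ i | inj₂ j | ⊎ᴾ.inj₂ p =
      ≡.trans (≡.sym (FP.splitAt⁻¹-↑ʳ ex)) (≡.trans (cong (a ↑ʳ_) (inj D i j p)) (FP.splitAt⁻¹-↑ʳ ey))

  Card-× : {A B : Set} {R : Rel A 0ℓ} {S : Rel B 0ℓ} {a b : ℕ} →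
    Card A R a → Card B S b → Card (A × B) (×-Pointwise R S) (a * b)
  Card-× {R = R} {S} {a} {b} C D = record { enum = enum× ; surj = surj× ; inj = inj× }
    where
    enum× : Fin (a * b) → _
    enum× x = enum C (proj₁ (remQuot {a} b x)) , enum D (proj₂ (remQuot {a} b x))
    surj× : ∀ z → ∃ λ x → ×-Pointwise R S (enum× x) z
    surj× (y , y') with surj C y | surj D y'
    ... | i , p | j , q = combine i j ,
      subst (λ t → ×-Pointwise R S (enum C (proj₁ t) , enum D (proj₂ t)) (y , y'))
            (≡.sym (FP.remQuot-combine {a} {b} i j)) (p , q)
    inj× : ∀ x y → ×-Pointwise R S (enum× x) (enum× y) → x ≡ y
    inj× x y (p , q) = ≡.trans (≡.sym (FP.combine-remQuot {a} b x))
      (≡.trans (cong₂ combine (inj C _ _ p) (inj D _ _ q)) (FP.combine-remQuot {a} b y))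

  data FibreRel {k : ℕ} {A : Fin k → Set} (R : ∀ i → Rel (A i) 0ℓ) : Rel (Σ (Fin k) A) 0ℓ where
    same-fibre : ∀ {i a a'} → R i a a' → FibreRel R (i , a) (i , a')

  Card-Σ : {k : ℕ} {A : Fin k → Set} {R : ∀ i → Rel (A i) 0ℓ} {c : Fin k → ℕ} →
    (∀ i → IsEquivalence (R i)) →
    (∀ i → Card (A i) (R i) (c i)) → Card (Σ (Fin k) A) (FibreRel R) (sum c)
  Card-Σ {zero} R-equiv C = record { enum = λ () ; surj = λ { (() , _) } ; inj = λ () }
  Card-Σ {suc k} {A} {R} R-equiv C =
    Card-map trans-Σ split split-resp split-refl split-surj
      (Card-⊎ (C F.zero) (Card-Σ (R-equiv ∘ F.suc) (C ∘ F.suc)))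
    where
    trans-Σ : Transitive (FibreRel R)
    trans-Σ (same-fibre p) (same-fibre q) = same-fibre (IsEquivalence.trans (R-equiv _) p q)
    split : A F.zero ⊎ Σ (Fin k) (A ∘ F.suc) → Σ (Fin (suc k)) A
    split (inj₁ a) = F.zero , a
    split (inj₂ (i , a)) = F.suc i , a
    split-resp : ∀ {x y} → ⊎-Pointwise (R F.zero) (FibreRel (R ∘ F.suc)) x y → FibreRel R (split x) (split y)
    split-resp (⊎ᴾ.inj₁ p) = same-fibre p
    split-resp (⊎ᴾ.inj₂ (same-fibre p)) = same-fibre p
    split-refl : ∀ x y → FibreRel R (split x) (split y) → ⊎-Pointwise (R F.zero) (FibreRel (R ∘ F.suc)) x y
    split-refl (inj₁ a) (inj₁ b) (same-fibre p) = ⊎ᴾ.inj₁ p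
    split-refl (inj₂ (i , a)) (inj₂ (.i , b)) (same-fibre p) = ⊎ᴾ.inj₂ (same-fibre p)
    split-surj : ∀ b → ∃ λ a → FibreRel R (split a) b
    split-surj (F.zero , a) = inj₁ a , same-fibre (IsEquivalence.refl (R-equiv F.zero))
    split-surj (F.suc i , a) = inj₂ (i , a) , same-fibre (IsEquivalence.refl (R-equiv (F.suc i)))

  ≤-sum : ∀ {k} (f : Fin k → ℕ) i → f i ℕ.≤ sum f
  ≤-sum f F.zero    = ℕP.m≤m+n _ _
  ≤-sum f (F.suc i) = ℕP.≤-trans (≤-sum (f ∘ F.suc) i) (ℕP.m≤n+m _ (f F.zero))

  record Representatives {A : Set} (R : Rel A 0ℓ) (xs : List A) : Set where
    field
      size     : ℕ
      rep      : Fin size → A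
      distinct : ∀ i j → R (rep i) (rep j) → i ≡ j
      covers   : ∀ {a} → Any (λ x → R x a) xs → ∃ λ i → R (rep i) a

  -- A decidable equivalence has a system of representatives for any list:
  -- keep an element iff it is inequivalent to all representatives so far.
  representatives : {A : Set} {R : Rel A 0ℓ} → IsEquivalence R → Decidable R →
    (xs : List A) → Representatives R xs
  representatives R-equiv R? [] =
    record { size = 0 ; rep = λ () ; distinct = λ () ; covers = λ () }
  representatives {A} {R} R-equiv R? (x ∷ xs)
    with Rs ← representatives R-equiv R? xs
       | FP.any? (λ i → R? (Representatives.rep Rs i) x)
  ... | yes (i , i∼x) = record
    { size = size ; rep = rep ; distinct = distinct
    ; covers = λ { (here x∼a) → i , trans i∼x x∼a ; (there a∈xs) → covers a∈xs } }
    where open Representatives Rs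
          open IsEquivalence R-equiv using (trans)
  ... | no x-new = record
    { size = suc size ; rep = x ◂ rep ; distinct = distinct′
    ; covers = λ { (here x∼a) → F.zero , x∼a
                 ; (there a∈xs) → let (i , r) = covers a∈xs in F.suc i , r } }
    where
    open Representatives Rs
    open IsEquivalence R-equiv using (sym)
    distinct′ : ∀ i j → R ((x ◂ rep) i) ((x ◂ rep) j) → i ≡ j
    distinct′ F.zero    F.zero    r = refl
    distinct′ F.zero    (F.suc j) r = ⊥-elim (x-new (j , sym r))
    distinct′ (F.suc i) F.zero    r = ⊥-elim (x-new (i , r))
    distinct′ (F.suc i) (F.suc j) r = cong F.suc (distinct i j r)

  Card-exists : {A : Set} {R : Rel A 0ℓ} → IsEquivalence R → Decidable R →
    (xs : List A) → (∀ a → Any (λ x → R x a) xs) → ∃ (Card A R)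
  Card-exists R-equiv R? xs cover = size , record
    { enum = rep ; surj = covers ∘ cover ; inj = distinct }
    where open Representatives (representatives R-equiv R? xs)

  functions : (m n : ℕ) → List (Fin m → Fin n)
  functions zero    n = (λ ()) ∷ []
  functions (suc m) n = concatMap (λ b → L.map (b ◂_) (functions m n)) (allFin n)

  functions-cover : ∀ {m n} (f : Fin m → Fin n) → Any (_≗ f) (functions m n)
  functions-cover {zero} f = here (λ ())
  functions-cover {suc m} {n} f = concatMap⁺ (λ b → L.map (b ◂_) (functions m n)) (Any.map extend (∈-allFin (f F.zero)))
    where
    extend : ∀ {b} → f F.zero ≡ b → Any (_≗ f) (L.map (b ◂_) (functions m n))
    extend refl = map⁺ (Any.map (λ g≗ → λ { F.zero → refl ; (F.suc i) → g≗ i })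
                                (functions-cover (f ∘ F.suc)))

  Card-subset : {m n : ℕ} (P : Pred (Fin m → Fin n) 0ℓ) → (∀ f → Dec (P f)) →
    (∀ {f g} → f ≗ g → P f → P g) →
    (R : Rel (Σ _ P) 0ℓ) → IsEquivalence R → Decidable R →
    (∀ {f g p q} → f ≗ g → R (f , p) (g , q)) →
    ∃ (Card (Σ _ P) R)
  Card-subset {m} {n} P P? P-resp R R-equiv R? R-pointwise =
    Card-exists R-equiv R? (mapMaybe candidate (functions m n))
      (λ { (f , p) → mapMaybe⁺ candidate (functions m n)
             (map⁺ (Any.map (candidate-hits p) (functions-cover f))) })
    where
    candidate : (f : Fin m → Fin n) → Maybe (Σ _ P)
    candidate f = Maybe.map (f ,_) (dec⇒maybe (P? f))
    candidate-hits : ∀ {f g} (q : P g) → f ≗ g → MAny.Any (λ y → R y (g , q)) (candidate f)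
    candidate-hits {f} q f≗g with P? f
    ... | yes p  = MAny.just (R-pointwise f≗g)
    ... | no ¬p = ⊥-elim (¬p (P-resp (≡.sym ∘ f≗g) q))

  least : ∀ {k} (P : Pred (Fin k) 0ℓ) → (∀ i → Dec (P i)) → ∃ P → Σ (Fin k) P
  least {zero} P P? (() , _)
  least {suc k} P P? (i , p) with P? F.zero
  ... | yes p0 = F.zero , p0
  ... | no ¬p0 = let (j , q) = least (P ∘ F.suc) (P? ∘ F.suc) (later i p) in F.suc j , q
    where
    later : ∀ i → P i → ∃ (P ∘ F.suc)
    later F.zero    p = ⊥-elim (¬p0 p)
    later (F.suc i) p = i , p

  least-cong : ∀ {k} (P Q : Pred (Fin k) 0ℓ) (P? : ∀ i → Dec (P i)) (Q? : ∀ i → Dec (Q i)) (∃P : ∃ P) (∃Q : ∃ Q) →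
    (∀ i → P i → Q i) → (∀ i → Q i → P i) →
    proj₁ (least P P? ∃P) ≡ proj₁ (least Q Q? ∃Q)
  least-cong {zero} P Q P? Q? (() , _) ∃Q P⇒Q Q⇒P
  least-cong {suc k} P Q P? Q? _ _ P⇒Q Q⇒P with P? F.zero | Q? F.zero
  ... | yes p0 | yes q0 = refl
  ... | yes p0 | no ¬q0 = ⊥-elim (¬q0 (P⇒Q _ p0))
  ... | no ¬p0 | yes q0 = ⊥-elim (¬p0 (Q⇒P _ q0))
  ... | no ¬p0 | no ¬q0 =
    cong F.suc (least-cong _ _ _ _ _ _ (P⇒Q ∘ F.suc) (Q⇒P ∘ F.suc))

module IncreasingMaps where

  open import Data.Nat as ℕ using (zero; z≤n; s≤s)
  import Data.Nat.Properties as ℕP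
  open import Data.Nat.Combinatorics using (_C_; nCk+nC[k+1]≡[n+1]C[k+1])
  open import Data.Fin as F using (toℕ; _<_)
  import Data.Fin.Properties as FP
  open import Data.Product using (∃; _,_; proj₁; proj₂)
  open import Data.Sum using (_⊎_; inj₁; inj₂)
  open import Data.Sum.Relation.Binary.Pointwise as ⊎ᴾ using () renaming (Pointwise to ⊎-Pointwise)
  open import Data.Empty using (⊥; ⊥-elim)
  open import Relation.Nullary using (Dec; yes; no)
  open import Relation.Unary using (Pred)
  open import Relation.Binary using (tri<; tri≈; tri>)
  open import Relation.Binary.PropositionalEquality using (refl; cong; subst)
  import Relation.Binary.PropositionalEquality as ≡
  open Counting using (Card-map; Card-⊎)

  Increasing : {k n : ℕ} → (Fin k → Fin n) → Set
  Increasing h = ∀ i j → i < j → h i < h j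

  Inc : ℕ → ℕ → Set
  Inc k n = Σ (Fin k → Fin n) Increasing

  _≗ᵢ_ : {k n : ℕ} → Rel (Inc k n) 0ℓ
  (h , _) ≗ᵢ (h' , _) = h ≗ h'

  increasing-injective : {k n : ℕ} {h : Fin k → Fin n} → Increasing h →
    ∀ i j → h i ≡ h j → i ≡ j
  increasing-injective h-inc i j e with FP.<-cmp i j
  ... | tri< i<j _ _ = ⊥-elim (FP.<⇒≢ (h-inc i j i<j) e)
  ... | tri≈ _ i≡j _ = i≡j
  ... | tri> _ _ j<i = ⊥-elim (FP.<⇒≢ (h-inc j i j<i) (≡.sym e))

  prepend : {k n : ℕ} → (Fin k → Fin n) → Fin (suc k) → Fin (suc n)
  prepend h F.zero    = F.zero
  prepend h (F.suc i) = F.suc (h i)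

  prepend-increasing : {k n : ℕ} {h : Fin k → Fin n} → Increasing h → Increasing (prepend h)
  prepend-increasing h-inc F.zero    (F.suc j) _       = s≤s z≤n
  prepend-increasing h-inc (F.suc i) (F.suc j) (s≤s p) = s≤s (h-inc i j p)

  shift-increasing : {k n : ℕ} {h : Fin k → Fin n} → Increasing h → Increasing (F.suc ∘ h)
  shift-increasing h-inc i j p = s≤s (h-inc i j p)

  predecessor : {n : ℕ} (x : Fin (suc n)) → 0 ℕ.< toℕ x → Fin n
  predecessor (F.suc y) _ = y

  suc-predecessor : {n : ℕ} (x : Fin (suc n)) (p : 0 ℕ.< toℕ x) → F.suc (predecessor x p) ≡ x
  suc-predecessor (F.suc y) _ = refl

  predecessor-< : {n : ℕ} {x y : Fin (suc n)} (p : 0 ℕ.< toℕ x) (q : 0 ℕ.< toℕ y) →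
    x < y → predecessor x p < predecessor y q
  predecessor-< {x = F.suc x} {F.suc y} p q (s≤s x<y) = x<y

  -- An increasing map [1+k] → [1+n] either hits 0 (at 0), and is then a
  -- prepended map [k] → [n], or avoids 0 and is a shifted map [1+k] → [n].
  prolong : {k n : ℕ} → Inc k n ⊎ Inc (suc k) n → Inc (suc k) (suc n)
  prolong (inj₁ (h , h-inc)) = prepend h , prepend-increasing h-inc
  prolong (inj₂ (h , h-inc)) = F.suc ∘ h , shift-increasing h-inc

  prolong-surj : ∀ {k n} (b : Inc (suc k) (suc n)) → ∃ λ a → prolong a ≗ᵢ b
  prolong-surj {k} {n} (H , H-inc) with H F.zero in H0
  ... | F.zero = inj₁ (h , h-inc) , agree
    where
    positive : ∀ i → 0 ℕ.< toℕ (H (F.suc i))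
    positive i = subst (λ t → toℕ t ℕ.< toℕ (H (F.suc i))) H0 (H-inc F.zero (F.suc i) (s≤s z≤n))
    h : Fin k → Fin n
    h i = predecessor (H (F.suc i)) (positive i)
    h-inc : Increasing h
    h-inc i j p = predecessor-< (positive i) (positive j) (H-inc (F.suc i) (F.suc j) (s≤s p))
    agree : prepend h ≗ H
    agree F.zero    = ≡.sym H0
    agree (F.suc i) = suc-predecessor _ (positive i)
  ... | F.suc _ = inj₂ (h , h-inc) , λ i → suc-predecessor _ (positive i)
    where
    positive : ∀ i → 0 ℕ.< toℕ (H i)
    positive F.zero    = subst (λ t → 0 ℕ.< toℕ t) (≡.sym H0) (s≤s z≤n)
    positive (F.suc i) = ℕP.<-trans (positive F.zero) (H-inc F.zero (F.suc i) (s≤s z≤n))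
    h : Fin (suc k) → Fin n
    h i = predecessor (H i) (positive i)
    h-inc : Increasing h
    h-inc i j p = predecessor-< (positive i) (positive j) (H-inc i j p)

  Card-Inc : ∀ k n → Card (Inc k n) _≗ᵢ_ (n C k)
  Card-Inc zero n = record
    { enum = λ _ → (λ ()) , (λ ()) ; surj = λ _ → F.zero , (λ ())
    ; inj = λ { F.zero F.zero _ → refl } }
  Card-Inc (suc k) zero = record
    { enum = λ () ; surj = λ { (h , _) → ⊥-elim (empty (h F.zero)) } ; inj = λ () }
    where empty : Fin 0 → ⊥
          empty ()
  Card-Inc (suc k) (suc n) =
    subst (Card (Inc (suc k) (suc n)) _≗ᵢ_) (nCk+nC[k+1]≡[n+1]C[k+1] n k)
      (Card-map (λ p q i → ≡.trans (p i) (q i)) prolong prolong-resp prolong-refl prolong-surj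
        (Card-⊎ (Card-Inc k n) (Card-Inc (suc k) n)))
    where
    prolong-resp : ∀ {a a' : Inc k n ⊎ Inc (suc k) n} → ⊎-Pointwise _≗ᵢ_ _≗ᵢ_ a a' → prolong a ≗ᵢ prolong a'
    prolong-resp (⊎ᴾ.inj₁ p) F.zero    = refl
    prolong-resp (⊎ᴾ.inj₁ p) (F.suc i) = cong F.suc (p i)
    prolong-resp (⊎ᴾ.inj₂ p) i         = cong F.suc (p i)
    prolong-refl : ∀ (a a' : Inc k n ⊎ Inc (suc k) n) → prolong a ≗ᵢ prolong a' → ⊎-Pointwise _≗ᵢ_ _≗ᵢ_ a a'
    prolong-refl (inj₁ _) (inj₁ _) p = ⊎ᴾ.inj₁ (FP.suc-injective ∘ p ∘ F.suc)
    prolong-refl (inj₁ _) (inj₂ _) p with p F.zero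
    ... | ()
    prolong-refl (inj₂ _) (inj₁ _) p with p F.zero
    ... | ()
    prolong-refl (inj₂ _) (inj₂ _) p = ⊎ᴾ.inj₂ (FP.suc-injective ∘ p)

  increasing-unique : ∀ {a b n} (h : Fin a → Fin n) (h' : Fin b → Fin n) →
    Increasing h → Increasing h' →
    (∀ i → ∃ λ i' → h i ≡ h' i') → (∀ i' → ∃ λ i → h' i' ≡ h i) →
    a ≡ b × (∀ i i' → toℕ i ≡ toℕ i' → h i ≡ h' i')
  increasing-unique {zero} {zero} h h' _ _ _ _ = refl , λ ()
  increasing-unique {zero} {suc b} h h' _ _ _ im' with im' F.zero
  ... | () , _
  increasing-unique {suc a} {zero} h h' _ _ im _ with im F.zero
  ... | () , _
  increasing-unique {suc a} {suc b} {n} h h' h-inc h'-inc im im' =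
    cong suc (proj₁ tails-equal) , agree
    where
    minimum : ∀ {c} (g : Fin (suc c) → Fin n) → Increasing g → ∀ i → g F.zero F.≤ g i
    minimum g g-inc F.zero    = ℕP.≤-refl
    minimum g g-inc (F.suc i) = ℕP.<⇒≤ (g-inc F.zero (F.suc i) (s≤s z≤n))
    heads-equal : h F.zero ≡ h' F.zero
    heads-equal = FP.≤-antisym
      (subst (h F.zero F.≤_) (≡.sym (proj₂ (im' F.zero))) (minimum h h-inc (proj₁ (im' F.zero))))
      (subst (h' F.zero F.≤_) (≡.sym (proj₂ (im F.zero))) (minimum h' h'-inc (proj₁ (im F.zero))))
    im-tail : ∀ i → ∃ λ i' → h (F.suc i) ≡ h' (F.suc i')
    im-tail i with im (F.suc i)
    ... | F.zero , p = ⊥-elim (FP.<⇒≢ (h-inc F.zero (F.suc i) (s≤s z≤n)) (≡.trans heads-equal (≡.sym p)))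
    ... | F.suc i' , p = i' , p
    im'-tail : ∀ i → ∃ λ i' → h' (F.suc i) ≡ h (F.suc i')
    im'-tail i with im' (F.suc i)
    ... | F.zero , p = ⊥-elim (FP.<⇒≢ (h'-inc F.zero (F.suc i) (s≤s z≤n)) (≡.trans (≡.sym heads-equal) (≡.sym p)))
    ... | F.suc i' , p = i' , p
    tails-equal : a ≡ b × (∀ i i' → toℕ i ≡ toℕ i' → h (F.suc i) ≡ h' (F.suc i'))
    tails-equal = increasing-unique (h ∘ F.suc) (h' ∘ F.suc)
      (λ i j p → h-inc (F.suc i) (F.suc j) (s≤s p)) (λ i j p → h'-inc (F.suc i) (F.suc j) (s≤s p))
      im-tail im'-tail
    agree : ∀ i i' → toℕ i ≡ toℕ i' → h i ≡ h' i'
    agree F.zero    F.zero     _ = heads-equal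
    agree (F.suc i) (F.suc i') p = proj₂ tails-equal i i' (ℕP.suc-injective p)

  record Enumeration {n : ℕ} (P : Pred (Fin n) 0ℓ) : Set where
    field
      size       : ℕ
      elem       : Fin size → Fin n
      elem-inc   : Increasing elem
      elem-in    : ∀ i → P (elem i)
      index      : ∀ x → P x → Fin size
      elem-index : ∀ x p → elem (index x p) ≡ x

  enumerate : ∀ {n} (P : Pred (Fin n) 0ℓ) → (∀ x → Dec (P x)) → Enumeration P
  enumerate {zero} P P? = record
    { size = 0 ; elem = λ () ; elem-inc = λ () ; elem-in = λ () ; index = λ () ; elem-index = λ () }
  enumerate {suc n} P P? with enumerate (P ∘ F.suc) (P? ∘ F.suc) | P? F.zero
  ... | E | yes P0 = record
    { size = suc size ; elem = prepend elem ; elem-inc = prepend-increasing elem-inc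
    ; elem-in    = λ { F.zero → P0 ; (F.suc i) → elem-in i }
    ; index      = λ { F.zero _ → F.zero ; (F.suc x) p → F.suc (index x p) }
    ; elem-index = λ { F.zero _ → refl ; (F.suc x) p → cong F.suc (elem-index x p) } }
    where open Enumeration E
  ... | E | no ¬P0 = record
    { size = size ; elem = F.suc ∘ elem ; elem-inc = shift-increasing elem-inc
    ; elem-in    = elem-in
    ; index      = λ { F.zero p → ⊥-elim (¬P0 p) ; (F.suc x) p → index x p }
    ; elem-index = λ { F.zero p → ⊥-elim (¬P0 p) ; (F.suc x) p → cong F.suc (elem-index x p) } }
    where open Enumeration E

  record Factorisation {m n : ℕ} (c : Fin m → Fin n) : Set where
    field
      k             : ℕ
      k≤m           : k ℕ.≤ m
      surjection    : Fin m → Fin k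
      onto          : ∀ i → ∃ λ v → surjection v ≡ i
      inclusion     : Fin k → Fin n
      inclusion-inc : Increasing inclusion
      factors       : ∀ v → inclusion (surjection v) ≡ c v

  image-factorisation : ∀ {m n} (c : Fin m → Fin n) → Factorisation c
  image-factorisation {m} {n} c = record
    { k = size ; k≤m = k≤m ; surjection = surjection ; onto = onto
    ; inclusion = elem ; inclusion-inc = elem-inc ; factors = λ v → elem-index (c v) (v , refl) }
    where
    Image : Pred (Fin n) 0ℓ
    Image y = ∃ λ v → c v ≡ y
    open Enumeration (enumerate Image (λ y → FP.any? (λ v → c v FP.≟ y)))
    surjection : Fin m → Fin size
    surjection v = index (c v) (v , refl)
    onto : ∀ i → ∃ λ v → surjection v ≡ i
    onto i = let (v , cv≡) = elem-in i in
      v , increasing-injective elem-inc _ _ (≡.trans (elem-index (c v) (v , refl)) cv≡)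
    k≤m : size ℕ.≤ m
    k≤m = FP.injective⇒≤ {f = proj₁ ∘ onto} λ {i} {j} e →
      ≡.trans (≡.sym (proj₂ (onto i))) (≡.trans (cong surjection e) (proj₂ (onto j)))

module OrbitCounting (G : Group 0ℓ 0ℓ) {X : Set} (_≈ₓ_ : Rel X 0ℓ) (≈ₓ-equiv : IsEquivalence _≈ₓ_)
  (_·_ : Group.Carrier G → X → X)
  (·-cong : ∀ {g h x y} → Group._≈_ G g h → x ≈ₓ y → (g · x) ≈ₓ (h · y))
  (·-identity : ∀ x → (Group.ε G · x) ≈ₓ x)
  (·-assoc : ∀ g h x → (Group._∙_ G g h · x) ≈ₓ (g · (h · x))) where

  open ℕΣ using (sum)
  open import Data.Nat using (_*_)
  open import Data.Product using (∃; _,_; proj₁; proj₂)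
  open import Data.Product.Relation.Binary.Pointwise.NonDependent using () renaming (Pointwise to ×-Pointwise)
  import Data.Fin.Properties as FP
  open import Relation.Nullary using (yes; no)
  open import Relation.Binary.PropositionalEquality using (refl; cong; subst)
  import Relation.Binary.PropositionalEquality as ≡
  open Group G renaming (refl to ≈-refl; sym to ≈-sym; trans to ≈-trans; reflexive to ≈-reflexive)
  open import Algebra.Properties.Group G using (//-rightDividesˡ; //-rightDividesʳ)
  open Relation.Binary using (Transitive)
  open IsEquivalence ≈ₓ-equiv using () renaming (refl to ≈ₓ-refl; sym to ≈ₓ-sym; trans to ≈ₓ-trans)
  open Counting
  open Card

  Xₛ : Setoid 0ℓ 0ℓ
  Xₛ = record { Carrier = X ; _≈_ = _≈ₓ_ ; isEquivalence = ≈ₓ-equiv }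

  SameOrbitₓ : Rel X 0ℓ
  SameOrbitₓ x y = ∃ λ g → (g · x) ≈ₓ y

  SameOrbitₓ-equiv : IsEquivalence SameOrbitₓ
  SameOrbitₓ-equiv = record
    { refl  = ε , ·-identity _
    ; sym   = λ { {x} {y} (g , gx≈y) → g ⁻¹ , (begin
                (g ⁻¹) · y       ≈⟨ ·-cong ≈-refl (≈ₓ-sym gx≈y) ⟩
                (g ⁻¹) · (g · x) ≈⟨ ·-assoc (g ⁻¹) g x ⟨
                (g ⁻¹ ∙ g) · x   ≈⟨ ·-cong (inverseˡ g) ≈ₓ-refl ⟩
                ε · x            ≈⟨ ·-identity x ⟩
                x                ∎) }
    ; trans = λ { {x} (g , gx≈y) (h , hy≈z) →
                h ∙ g , ≈ₓ-trans (·-assoc h g x) (≈ₓ-trans (·-cong ≈-refl gx≈y) hy≈z) } }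
    where open Relation.Binary.Reasoning.Setoid Xₛ

  Fixes : Carrier → X → Set
  Fixes g x = (g · x) ≈ₓ x

  FixedPair : Set
  FixedPair = Σ Carrier λ g → Σ X (Fixes g)

  -- componentwise equivalence of fixed pairs (a record rather than a
  -- product, so that the compared pairs can be inferred from a proof)
  record _≈ᶠ_ (a b : FixedPair) : Set where
    constructor _,_
    field
      element-≈ : proj₁ a ≈ proj₁ b
      point-≈   : proj₁ (proj₂ a) ≈ₓ proj₁ (proj₂ b)

  ≈ᶠ-trans : Transitive _≈ᶠ_
  ≈ᶠ-trans (p , q) (p' , q') = ≈-trans p p' , ≈ₓ-trans q q'

  ≈ᶠ-equiv : IsEquivalence _≈ᶠ_
  ≈ᶠ-equiv = record
    { refl  = ≈-refl , ≈ₓ-refl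
    ; sym   = λ (p , q) → ≈-sym p , ≈ₓ-sym q
    ; trans = ≈ᶠ-trans }

  module Finite {oG : ℕ} (CG : Card Carrier _≈_ oG) where

    open Card CG using () renaming (enum to elementG)

    indexG : Carrier → Fin oG
    indexG g = proj₁ (surj CG g)

    elementG-indexG : ∀ g → elementG (indexG g) ≈ g
    elementG-indexG g = proj₂ (surj CG g)

    sameOrbit? : Relation.Binary.Decidable _≈ₓ_ → Relation.Binary.Decidable SameOrbitₓ
    sameOrbit? _≈ₓ?_ x y with FP.any? (λ i → (elementG i · x) ≈ₓ? y)
    ... | yes (i , p) = yes (elementG i , p)
    ... | no ¬p = no λ (g , gx≈y) → ¬p (indexG g , ≈ₓ-trans (·-cong (elementG-indexG g) ≈ₓ-refl) gx≈y)

    Card-FixedPair-by-element : {c : Fin oG → ℕ} →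
      (∀ i → Card (Σ X (Fixes (elementG i))) (λ a b → proj₁ a ≈ₓ proj₁ b) (c i)) →
      Card FixedPair _≈ᶠ_ (sum c)
    Card-FixedPair-by-element C = Card-map ≈ᶠ-trans pair pair-resp pair-refl pair-surj
      (Card-Σ (λ _ → record { refl = ≈ₓ-refl ; sym = ≈ₓ-sym ; trans = ≈ₓ-trans }) C)
      where
      pair : Σ (Fin oG) (λ i → Σ X (Fixes (elementG i))) → FixedPair
      pair (i , x , fixed) = elementG i , x , fixed
      pair-resp : ∀ {a a'} → FibreRel (λ i a b → proj₁ a ≈ₓ proj₁ b) a a' → pair a ≈ᶠ pair a'
      pair-resp (same-fibre x≈y) = ≈-refl , x≈y
      pair-refl : ∀ a a' → pair a ≈ᶠ pair a' → FibreRel (λ i a b → proj₁ a ≈ₓ proj₁ b) a a'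
      pair-refl (i , a) (j , b) (gᵢ≈gⱼ , x≈y) with inj CG i j gᵢ≈gⱼ
      ... | refl = same-fibre x≈y
      pair-surj : ∀ b → ∃ λ a → pair a ≈ᶠ b
      pair-surj (g , x , fixed) =
        (indexG g , x , ≈ₓ-trans (·-cong (elementG-indexG g) ≈ₓ-refl) fixed) ,
        elementG-indexG g , ≈ₓ-refl

    -- Writing r(i) for the chosen representative of orbit i and
    -- t(x) for a transporter with t(x) · r(orbit of x) ≈ x, the map
    -- (a , i) ↦ (a t(y)⁻¹ , y) with y = a · r(i) is a bijection
    -- G × [χ] → FixedPair up to the equivalences; its inverse is
    -- (g , x) ↦ (g t(x) , orbit of x).  The transporter is chosen as the
    -- least suitable group element so that it respects ≈ₓ.
    module _ (_≈ₓ?_ : Relation.Binary.Decidable _≈ₓ_) {χ : ℕ} (CO : Card X SameOrbitₓ χ) where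

      open Card CO using () renaming (enum to representative)
      open IsEquivalence SameOrbitₓ-equiv using ()
        renaming (sym to orbit-sym; trans to orbit-trans)

      orbit : X → Fin χ
      orbit x = proj₁ (surj CO x)

      representative-orbit : ∀ x → SameOrbitₓ (representative (orbit x)) x
      representative-orbit x = proj₂ (surj CO x)

      orbit-of : ∀ {i x} → SameOrbitₓ (representative i) x → orbit x ≡ i
      orbit-of {i} {x} p = inj CO _ _ (orbit-trans (representative-orbit x) (orbit-sym p))

      orbit-cong : ∀ {x y} → x ≈ₓ y → orbit x ≡ orbit y
      orbit-cong {x} x≈y =
        ≡.sym (orbit-of (orbit-trans (representative-orbit x) (ε , ≈ₓ-trans (·-identity x) x≈y)))

      Transports : X → Fin oG → Set
      Transports x j = (elementG j · representative (orbit x)) ≈ₓ x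

      some-transporter : ∀ x → ∃ (Transports x)
      some-transporter x = let (g , p) = representative-orbit x in
        indexG g , ≈ₓ-trans (·-cong (elementG-indexG g) ≈ₓ-refl) p

      least-transporter : (x : X) → Σ (Fin oG) (Transports x)
      least-transporter x =
        least (Transports x) (λ j → (elementG j · representative (orbit x)) ≈ₓ? x) (some-transporter x)

      transporter : X → Carrier
      transporter x = elementG (proj₁ (least-transporter x))

      transporter-spec : ∀ x → (transporter x · representative (orbit x)) ≈ₓ x
      transporter-spec x = proj₂ (least-transporter x)

      transporter-cong : ∀ {x y} → x ≈ₓ y → transporter x ≈ transporter y
      transporter-cong {x} {y} x≈y = ≈-reflexive (cong elementG (least-cong _ _ _ _ _ _
        (λ j p → ≈ₓ-trans (subst (λ o → (elementG j · representative o) ≈ₓ x) (orbit-cong x≈y) p) x≈y)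
        (λ j p → ≈ₓ-trans (subst (λ o → (elementG j · representative o) ≈ₓ y) (≡.sym (orbit-cong x≈y)) p) (≈ₓ-sym x≈y))))

      point : Carrier → Fin χ → X
      point a i = a · representative i

      orbit-point : ∀ a i → orbit (point a i) ≡ i
      orbit-point a i = orbit-of (a , ≈ₓ-refl)

      point-fixed : ∀ a i → Fixes (a ∙ transporter (point a i) ⁻¹) (point a i)
      point-fixed a i = begin
        (a ∙ t ⁻¹) · y                                ≈⟨ ·-cong ≈-refl (transporter-spec y) ⟨
        (a ∙ t ⁻¹) · (t · representative (orbit y))   ≈⟨ ·-assoc (a ∙ t ⁻¹) t _ ⟨
        ((a ∙ t ⁻¹) ∙ t) · representative (orbit y)   ≈⟨ ·-cong (//-rightDividesˡ t a) ≈ₓ-refl ⟩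
        a · representative (orbit y)                  ≡⟨ cong (point a) (orbit-point a i) ⟩
        y                                             ∎
        where
        open Relation.Binary.Reasoning.Setoid Xₛ
        y : X
        y = point a i
        t : Carrier
        t = transporter y

      Card-FixedPair : Card FixedPair _≈ᶠ_ (oG * χ)
      Card-FixedPair = Card-map ≈ᶠ-trans stabilise stabilise-resp stabilise-refl stabilise-surj
        (Card-× CG (Card-Fin χ))
        where
        stabilise : Carrier × Fin χ → FixedPair
        stabilise (a , i) = a ∙ transporter (point a i) ⁻¹ , point a i , point-fixed a i
        stabilise-resp : ∀ {x y} → ×-Pointwise _≈_ _≡_ x y → stabilise x ≈ᶠ stabilise y
        stabilise-resp {a , i} {a' , .i} (a≈a' , refl) =
          ∙-cong a≈a' (⁻¹-cong (transporter-cong y≈y')) , y≈y'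
          where y≈y' : point a i ≈ₓ point a' i
                y≈y' = ·-cong a≈a' ≈ₓ-refl
        stabilise-refl : ∀ x y → stabilise x ≈ᶠ stabilise y → ×-Pointwise _≈_ _≡_ x y
        stabilise-refl (a , i) (a' , i') (g≈g' , y≈y') =
          ≈-trans (≈-sym (//-rightDividesˡ _ a))
            (≈-trans (∙-cong g≈g' (transporter-cong y≈y')) (//-rightDividesˡ _ a')) ,
          ≡.trans (≡.sym (orbit-point a i)) (≡.trans (orbit-cong y≈y') (orbit-point a' i'))
        stabilise-surj : ∀ b → ∃ λ x → stabilise x ≈ᶠ b
        stabilise-surj (g , x , fixed) = (g ∙ transporter x , orbit x) , g≈ , y≈x
          where
          y≈x : point (g ∙ transporter x) (orbit x) ≈ₓ x
          y≈x = ≈ₓ-trans (·-assoc g _ _) (≈ₓ-trans (·-cong ≈-refl (transporter-spec x)) fixed)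
          g≈ : (g ∙ transporter x) ∙ transporter (point (g ∙ transporter x) (orbit x)) ⁻¹ ≈ g
          g≈ = ≈-trans (∙-cong ≈-refl (⁻¹-cong (transporter-cong y≈x))) (//-rightDividesʳ _ g)

      burnside : {c : Fin oG → ℕ} →
        (∀ i → Card (Σ X (Fixes (elementG i))) (λ a b → proj₁ a ≈ₓ proj₁ b) (c i)) →
        oG * χ ≡ sum c
      burnside C = Card-unique ≈ᶠ-equiv Card-FixedPair (Card-FixedPair-by-element C)

module BinomialPolynomials where

  open import Data.Nat as ℕ using (zero; _!)
  import Data.Nat.Properties as ℕP
  open import Data.Nat.Combinatorics using (_C_; nCk+nC[k+1]≡[n+1]C[k+1])
  open import Data.Nat.Tactic.RingSolver using (solve-∀)
  open import Data.Fin as F using (toℕ; inject₁)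
  import Data.Fin.Properties as FP
  import Data.Integer as ℤ
  import Data.Integer.Properties as ℤP
  open import Data.Nat.Divisibility using (∣1⇒≡1)
  open import Data.Product using (_,_)
  open import Data.Rational as ℚ using (1ℚ; mkℚ; _+_; _*_; -_; _-_)
  import Data.Rational.Properties as ℚP
  open import Data.Rational.Solver using (module +-*-Solver)
  open +-*-Solver
  open import Relation.Binary.PropositionalEquality using (refl; cong; cong₂; module ≡-Reasoning)
  import Relation.Binary.PropositionalEquality as ≡
  module ℚΣ = Algebra.Properties.Semiring.Sum (Ring.semiring ℚP.+-*-ring)

  ℕtoℚ-mkℚ : (k : ℕ) → ℕtoℚ k ≡ mkℚ (ℤ.+ k) 0 (λ {(_ , d∣1) → ∣1⇒≡1 d∣1})
  ℕtoℚ-mkℚ k = ℚP.↥p/↧p≡p (mkℚ (ℤ.+ k) 0 (λ {(_ , d∣1) → ∣1⇒≡1 d∣1}))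

  ℕtoℚ-suc : (k : ℕ) → ℕtoℚ (suc k) ≡ 1ℚ + ℕtoℚ k
  ℕtoℚ-suc k rewrite ℕtoℚ-mkℚ k = ≡.sym (cong (λ z → (ℤ.+ 1 ℤ.+ z) ℚ./ 1) (ℤP.*-identityʳ (ℤ.+ k)))

  ℕtoℚ-zero : (k : ℕ) → ℕtoℚ k ≡ 0ℚ → k ≡ 0
  ℕtoℚ-zero k e = ℤP.+-injective (cong ℚ.↥_ (≡.trans (≡.sym (ℕtoℚ-mkℚ k)) e))

  ℕtoℚ-+ : (a b : ℕ) → ℕtoℚ (a ℕ.+ b) ≡ ℕtoℚ a + ℕtoℚ b
  ℕtoℚ-+ zero b = ≡.sym (ℚP.+-identityˡ (ℕtoℚ b))
  ℕtoℚ-+ (suc a) b = begin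
    ℕtoℚ (suc (a ℕ.+ b))      ≡⟨ ℕtoℚ-suc (a ℕ.+ b) ⟩
    1ℚ + ℕtoℚ (a ℕ.+ b)       ≡⟨ cong (1ℚ +_) (ℕtoℚ-+ a b) ⟩
    1ℚ + (ℕtoℚ a + ℕtoℚ b)    ≡⟨ ℚP.+-assoc 1ℚ (ℕtoℚ a) (ℕtoℚ b) ⟨
    (1ℚ + ℕtoℚ a) + ℕtoℚ b    ≡⟨ cong (_+ ℕtoℚ b) (ℕtoℚ-suc a) ⟨
    ℕtoℚ (suc a) + ℕtoℚ b     ∎
    where open ≡-Reasoning

  ℕtoℚ-* : (a b : ℕ) → ℕtoℚ (a ℕ.* b) ≡ ℕtoℚ a * ℕtoℚ b
  ℕtoℚ-* zero b = ≡.sym (ℚP.*-zeroˡ (ℕtoℚ b))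
  ℕtoℚ-* (suc a) b = begin
    ℕtoℚ (b ℕ.+ a ℕ.* b)        ≡⟨ ℕtoℚ-+ b (a ℕ.* b) ⟩
    ℕtoℚ b + ℕtoℚ (a ℕ.* b)     ≡⟨ cong (ℕtoℚ b +_) (ℕtoℚ-* a b) ⟩
    ℕtoℚ b + ℕtoℚ a * ℕtoℚ b    ≡⟨ solve 2 (λ A B → B :+ A :* B := (con 1ℚ :+ A) :* B) refl (ℕtoℚ a) (ℕtoℚ b) ⟩
    (1ℚ + ℕtoℚ a) * ℕtoℚ b      ≡⟨ cong (_* ℕtoℚ b) (ℕtoℚ-suc a) ⟨
    ℕtoℚ (suc a) * ℕtoℚ b       ∎
    where open ≡-Reasoning

  ℕtoℚ-sum : ∀ {k} (f : Fin k → ℕ) → ℕtoℚ (ℕΣ.sum f) ≡ ℚΣ.sum (ℕtoℚ ∘ f)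
  ℕtoℚ-sum {zero}  f = refl
  ℕtoℚ-sum {suc k} f = ≡.trans (ℕtoℚ-+ (f F.zero) _) (cong (ℕtoℚ (f F.zero) +_) (ℕtoℚ-sum (f ∘ F.suc)))

  1/ℕ : (k : ℕ) → k ≢ 0 → ℚ
  1/ℕ k k≢0 = ℚ.1/_ (ℕtoℚ k) {{ℚ.≢-nonZero (k≢0 ∘ ℕtoℚ-zero k)}}

  1/ℕ-inverse : (k : ℕ) (k≢0 : k ≢ 0) → 1/ℕ k k≢0 * ℕtoℚ k ≡ 1ℚ
  1/ℕ-inverse k k≢0 = ℚP.*-inverseˡ (ℕtoℚ k) {{ℚ.≢-nonZero (k≢0 ∘ ℕtoℚ-zero k)}}

  evalPoly-cong : ∀ d (a b : Fin (suc d) → ℚ) → a ≗ b → ∀ x → evalPoly d a x ≡ evalPoly d b x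
  evalPoly-cong zero    a b a≗b x = a≗b F.zero
  evalPoly-cong (suc d) a b a≗b x = cong₂ (λ u v → u + v * (x ^ℚ suc d))
    (evalPoly-cong d _ _ (a≗b ∘ inject₁) x) (a≗b (fromℕ (suc d)))

  evalPoly-+ : ∀ d (a b : Fin (suc d) → ℚ) x →
    evalPoly d (λ i → a i + b i) x ≡ evalPoly d a x + evalPoly d b x
  evalPoly-+ zero    a b x = refl
  evalPoly-+ (suc d) a b x =
    ≡.trans (cong (λ u → u + (a (fromℕ (suc d)) + b (fromℕ (suc d))) * (x ^ℚ suc d))
                  (evalPoly-+ d (a ∘ inject₁) (b ∘ inject₁) x))
            (solve 5 (λ A B p q X → (A :+ B) :+ (p :+ q) :* X := (A :+ p :* X) :+ (B :+ q :* X)) refl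
              (evalPoly d (a ∘ inject₁) x) (evalPoly d (b ∘ inject₁) x)
              (a (fromℕ (suc d))) (b (fromℕ (suc d))) (x ^ℚ suc d))

  evalPoly-* : ∀ d (k : ℚ) (a : Fin (suc d) → ℚ) x →
    evalPoly d (λ i → k * a i) x ≡ k * evalPoly d a x
  evalPoly-* zero    k a x = refl
  evalPoly-* (suc d) k a x =
    ≡.trans (cong (λ u → u + (k * a (fromℕ (suc d))) * (x ^ℚ suc d)) (evalPoly-* d k (a ∘ inject₁) x))
            (solve 4 (λ K A p X → K :* A :+ (K :* p) :* X := K :* (A :+ p :* X)) refl
              k (evalPoly d (a ∘ inject₁) x) (a (fromℕ (suc d))) (x ^ℚ suc d))

  snoc : ∀ {d} → (Fin (suc d) → ℚ) → ℚ → Fin (suc (suc d)) → ℚ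
  snoc {zero}  a z F.zero    = a F.zero
  snoc {zero}  a z (F.suc _) = z
  snoc {suc d} a z F.zero    = a F.zero
  snoc {suc d} a z (F.suc i) = snoc (a ∘ F.suc) z i

  snoc-inject₁ : ∀ {d} (a : Fin (suc d) → ℚ) z i → snoc a z (inject₁ i) ≡ a i
  snoc-inject₁ {zero}  a z F.zero    = refl
  snoc-inject₁ {suc d} a z F.zero    = refl
  snoc-inject₁ {suc d} a z (F.suc i) = snoc-inject₁ (a ∘ F.suc) z i

  snoc-last : ∀ {d} (a : Fin (suc d) → ℚ) z → snoc a z (fromℕ (suc d)) ≡ z
  snoc-last {zero}  a z = refl
  snoc-last {suc d} a z = snoc-last (a ∘ F.suc) z

  shift : ∀ {d} → (Fin (suc d) → ℚ) → Fin (suc (suc d)) → ℚ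
  shift a F.zero    = 0ℚ
  shift a (F.suc i) = a i

  evalPoly-shift : ∀ d (a : Fin (suc d) → ℚ) x → evalPoly (suc d) (shift a) x ≡ x * evalPoly d a x
  evalPoly-shift zero a x = solve 2 (λ A X → con 0ℚ :+ A :* (X :* con 1ℚ) := X :* A) refl (a F.zero) x
  evalPoly-shift (suc d) a x =
    ≡.trans (cong (λ u → u + a (fromℕ (suc d)) * (x ^ℚ suc (suc d)))
              (≡.trans (evalPoly-cong (suc d) (shift a ∘ inject₁) (shift (a ∘ inject₁))
                          (λ { F.zero → refl ; (F.suc i) → refl }) x)
                       (evalPoly-shift d (a ∘ inject₁) x)))
            (solve 4 (λ X E p Y → X :* E :+ p :* (X :* Y) := X :* (E :+ p :* Y)) refl
              x (evalPoly d (a ∘ inject₁) x) (a (fromℕ (suc d))) (x ^ℚ suc d))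

  record Poly (d : ℕ) (f : ℚ → ℚ) (L : ℚ) : Set where
    field
      coef : Fin (suc d) → ℚ
      lead : coef (fromℕ d) ≡ L
      eval : ∀ x → f x ≡ evalPoly d coef x
  open Poly

  poly-ext : ∀ {d f g L L'} → f ≗ g → L ≡ L' → Poly d f L → Poly d g L'
  poly-ext f≗g L≡L' p = record
    { coef = coef p ; lead = ≡.trans (lead p) L≡L' ; eval = λ x → ≡.trans (≡.sym (f≗g x)) (eval p x) }

  poly-raise : ∀ {d f L} → Poly d f L → Poly (suc d) f 0ℚ
  poly-raise {d} {f} p = record
    { coef = a′
    ; lead = snoc-last (coef p) 0ℚ
    ; eval = λ x → begin
        f x                                           ≡⟨ eval p x ⟩
        evalPoly d (coef p) x                         ≡⟨ evalPoly-cong d _ _ (≡.sym ∘ snoc-inject₁ (coef p) 0ℚ) x ⟩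
        evalPoly d (a′ ∘ inject₁) x                   ≡⟨ ℚP.+-identityʳ _ ⟨
        evalPoly d (a′ ∘ inject₁) x + 0ℚ              ≡⟨ cong (evalPoly d (a′ ∘ inject₁) x +_) (ℚP.*-zeroˡ (x ^ℚ suc d)) ⟨
        evalPoly d (a′ ∘ inject₁) x + 0ℚ * (x ^ℚ suc d)
          ≡⟨ cong (λ z → evalPoly d (a′ ∘ inject₁) x + z * (x ^ℚ suc d)) (snoc-last (coef p) 0ℚ) ⟨
        evalPoly (suc d) a′ x                         ∎ }
    where
    open ≡-Reasoning
    a′ : Fin (suc (suc d)) → ℚ
    a′ = snoc (coef p) 0ℚ

  poly-+ : ∀ {d f g L M} → Poly d f L → Poly d g M → Poly d (λ x → f x + g x) (L + M)
  poly-+ {d} p q = record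
    { coef = λ i → coef p i + coef q i
    ; lead = cong₂ _+_ (lead p) (lead q)
    ; eval = λ x → ≡.trans (cong₂ _+_ (eval p x) (eval q x)) (≡.sym (evalPoly-+ d (coef p) (coef q) x)) }

  poly-scale : ∀ {d f L} (k : ℚ) → Poly d f L → Poly d (λ x → k * f x) (k * L)
  poly-scale {d} k p = record
    { coef = λ i → k * coef p i
    ; lead = cong (k *_) (lead p)
    ; eval = λ x → ≡.trans (cong (k *_) (eval p x)) (≡.sym (evalPoly-* d k (coef p) x)) }

  poly-*X : ∀ {d f L} → Poly d f L → Poly (suc d) (λ x → x * f x) L
  poly-*X {d} p = record
    { coef = shift (coef p)
    ; lead = lead p
    ; eval = λ x → ≡.trans (cong (x *_) (eval p x)) (≡.sym (evalPoly-shift d (coef p) x)) }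

  poly-*linear : ∀ {d f L} (c : ℚ) → Poly d f L → Poly (suc d) (λ x → (x - c) * f x) L
  poly-*linear {d} {f} {L} c p =
    poly-ext (λ x → solve 3 (λ X C Y → X :* Y :+ (:- C) :* Y := (X :- C) :* Y) refl x c (f x))
             (≡.trans (cong (L +_) (ℚP.*-zeroʳ (- c))) (ℚP.+-identityʳ L))
             (poly-+ (poly-*X p) (poly-scale (- c) (poly-raise p)))

  poly-combination : (b : ℕ → ℚ → ℚ) (L : ℕ → ℚ) → (∀ j → Poly j (b j) (L j)) →
    ∀ d (w : Fin (suc d) → ℚ) →
    Poly d (λ x → ℚΣ.sum (λ j → w j * b (toℕ j) x)) (w (fromℕ d) * L d)
  poly-combination b L b-poly zero w =
    poly-ext (λ x → ≡.sym (ℚP.+-identityʳ _)) refl (poly-scale (w F.zero) (b-poly 0))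
  poly-combination b L b-poly (suc d) w =
    poly-ext (λ x → ≡.sym (≡.trans (ℚΣ.sum-init-last (λ j → w j * b (toℕ j) x))
                                   (cong₂ _+_ (ℚΣ.sum-cong-≗ (λ j → cong (λ t → w (inject₁ j) * b t x) (FP.toℕ-inject₁ j)))
                                              (cong (λ t → w (fromℕ (suc d)) * b t x) (FP.toℕ-fromℕ (suc d))))))
             (ℚP.+-identityˡ _)
             (poly-+ (poly-raise (poly-combination b L b-poly d (w ∘ inject₁)))
                     (poly-scale (w (fromℕ (suc d))) (b-poly (suc d))))

  falling : ℕ → ℚ → ℚ
  falling zero    x = 1ℚ
  falling (suc j) x = (x - ℕtoℚ j) * falling j x

  falling-poly : ∀ j → Poly j (falling j) 1ℚ
  falling-poly zero    = record { coef = λ _ → 1ℚ ; lead = refl ; eval = λ _ → refl }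
  falling-poly (suc j) = poly-*linear (ℕtoℚ j) (falling-poly j)

  falling-at-0 : ∀ j → falling (suc j) 0ℚ ≡ 0ℚ
  falling-at-0 zero    = refl
  falling-at-0 (suc j) = ≡.trans (cong ((0ℚ - ℕtoℚ (suc j)) *_) (falling-at-0 j)) (ℚP.*-zeroʳ (0ℚ - ℕtoℚ (suc j)))

  falling-suc : ∀ j x → falling (suc j) (1ℚ + x) ≡ (1ℚ + x) * falling j x
  falling-suc zero x = solve 1 (λ X → (con 1ℚ :+ X :- con 0ℚ) :* con 1ℚ := (con 1ℚ :+ X) :* con 1ℚ) refl x
  falling-suc (suc j) x =
    ≡.trans (cong₂ (λ u v → ((1ℚ + x) - u) * v) (ℕtoℚ-suc j) (falling-suc j x))
      (solve 3 (λ X J P → ((con 1ℚ :+ X) :- (con 1ℚ :+ J)) :* ((con 1ℚ :+ X) :* P)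
                        := (con 1ℚ :+ X) :* ((X :- J) :* P)) refl x (ℕtoℚ j) (falling j x))

  falling-at-ℕ : ∀ n j → falling j (ℕtoℚ n) ≡ ℕtoℚ ((n C j) ℕ.* j !)
  falling-at-ℕ n       zero    = refl
  falling-at-ℕ zero    (suc j) = falling-at-0 j
  falling-at-ℕ (suc n) (suc j) = begin
    falling (suc j) (ℕtoℚ (suc n))                    ≡⟨ cong (falling (suc j)) (ℕtoℚ-suc n) ⟩
    falling (suc j) (1ℚ + N)                          ≡⟨ falling-suc j N ⟩
    (1ℚ + N) * falling j N                            ≡⟨ solve 3 (λ X J P → (con 1ℚ :+ X) :* P := (con 1ℚ :+ J) :* P :+ (X :- J) :* P)
                                                                refl N (ℕtoℚ j) (falling j N) ⟩
    (1ℚ + ℕtoℚ j) * falling j N + falling (suc j) N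
      ≡⟨ cong₂ _+_ (cong₂ _*_ (≡.sym (ℕtoℚ-suc j)) (falling-at-ℕ n j)) (falling-at-ℕ n (suc j)) ⟩
    ℕtoℚ (suc j) * ℕtoℚ (a ℕ.* j !) + ℕtoℚ (b ℕ.* suc j !)
      ≡⟨ ≡.trans (ℕtoℚ-+ (suc j ℕ.* (a ℕ.* j !)) (b ℕ.* suc j !))
                 (cong (_+ ℕtoℚ (b ℕ.* suc j !)) (ℕtoℚ-* (suc j) (a ℕ.* j !))) ⟨
    ℕtoℚ (suc j ℕ.* (a ℕ.* j !) ℕ.+ b ℕ.* suc j !)    ≡⟨ cong ℕtoℚ (regroup (suc j) a b (j !)) ⟩
    ℕtoℚ ((a ℕ.+ b) ℕ.* suc j !)                      ≡⟨ cong (λ c → ℕtoℚ (c ℕ.* suc j !)) (nCk+nC[k+1]≡[n+1]C[k+1] n j) ⟩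
    ℕtoℚ ((suc n C suc j) ℕ.* suc j !)                ∎
    where
    open ≡-Reasoning
    N : ℚ
    N = ℕtoℚ n
    a b : ℕ
    a = n C j
    b = n C suc j
    regroup : ∀ s a b f → s ℕ.* (a ℕ.* f) ℕ.+ b ℕ.* (s ℕ.* f) ≡ (a ℕ.+ b) ℕ.* (s ℕ.* f)
    regroup = solve-∀

  j!≢0 : ∀ j → j ! ≢ 0
  j!≢0 j = ℕ.≢-nonZero⁻¹ (j !) {{ℕP._!≢0 j}}

  binomial : ℕ → ℚ → ℚ
  binomial j x = 1/ℕ (j !) (j!≢0 j) * falling j x

  binomial-poly : ∀ j → Poly j (binomial j) (1/ℕ (j !) (j!≢0 j))
  binomial-poly j = poly-ext (λ _ → refl) (ℚP.*-identityʳ _) (poly-scale (1/ℕ (j !) (j!≢0 j)) (falling-poly j))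

  binomial-at-ℕ : ∀ n j → binomial j (ℕtoℚ n) ≡ ℕtoℚ (n C j)
  binomial-at-ℕ n j = begin
    i * falling j (ℕtoℚ n)               ≡⟨ cong (i *_) (≡.trans (falling-at-ℕ n j) (ℕtoℚ-* (n C j) (j !))) ⟩
    i * (ℕtoℚ (n C j) * ℕtoℚ (j !))
      ≡⟨ solve 3 (λ I C F → I :* (C :* F) := C :* (I :* F)) refl i (ℕtoℚ (n C j)) (ℕtoℚ (j !)) ⟩
    ℕtoℚ (n C j) * (i * ℕtoℚ (j !))      ≡⟨ cong (ℕtoℚ (n C j) *_) (1/ℕ-inverse (j !) (j!≢0 j)) ⟩
    ℕtoℚ (n C j) * 1ℚ                    ≡⟨ ℚP.*-identityʳ (ℕtoℚ (n C j)) ⟩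
    ℕtoℚ (n C j)                         ∎
    where
    open ≡-Reasoning
    i : ℚ
    i = 1/ℕ (j !) (j!≢0 j)

  -- If N · χ(n) = Σ_{j ≤ m} T_j (n C j) for all n, where N ≠ 0 and T_m ≠ 0,
  -- then χ is given by a rational polynomial of degree exactly m, namely
  -- Σ_j (T_j / N) · binomial j.
  binomial-expansion-poly : (N : ℕ) → N ≢ 0 → (m : ℕ) (T : Fin (suc m) → ℕ) → T (fromℕ m) ≢ 0 →
    Σ (Fin (suc m) → ℚ) λ a → (a (fromℕ m) ≢ 0ℚ) ×
      ((n χ : ℕ) → N ℕ.* χ ≡ ℕΣ.sum (λ j → T j ℕ.* (n C toℕ j)) → ℕtoℚ χ ≡ evalPoly m a (ℕtoℚ n))
  binomial-expansion-poly N N≢0 m T Tm≢0 = coef P , lead≢0 , values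
    where
    open ≡-Reasoning
    1/N : ℚ
    1/N = 1/ℕ N N≢0
    w : Fin (suc m) → ℚ
    w j = 1/N * ℕtoℚ (T j)
    P : Poly m (λ x → ℚΣ.sum (λ j → w j * binomial (toℕ j) x)) (w (fromℕ m) * 1/ℕ (m !) (j!≢0 m))
    P = poly-combination binomial (λ j → 1/ℕ (j !) (j!≢0 j)) binomial-poly m w

    lead≢0 : coef P (fromℕ m) ≢ 0ℚ
    lead≢0 lead≡0 = Tm≢0 (ℕtoℚ-zero (T (fromℕ m)) (begin
      Tm                                  ≡⟨ ℚP.*-identityʳ Tm ⟨
      Tm * 1ℚ                             ≡⟨ cong (Tm *_) (cong₂ _*_ (1/ℕ-inverse N N≢0) (1/ℕ-inverse (m !) (j!≢0 m))) ⟨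
      Tm * ((1/N * ℕtoℚ N) * (1/m! * ℕtoℚ (m !)))
        ≡⟨ solve 5 (λ T a n b f → T :* ((a :* n) :* (b :* f)) := ((a :* T) :* b) :* (n :* f)) refl
                   Tm 1/N (ℕtoℚ N) 1/m! (ℕtoℚ (m !)) ⟩
      (w (fromℕ m) * 1/m!) * (ℕtoℚ N * ℕtoℚ (m !)) ≡⟨ cong (_* (ℕtoℚ N * ℕtoℚ (m !))) (≡.trans (≡.sym (lead P)) lead≡0) ⟩
      0ℚ * (ℕtoℚ N * ℕtoℚ (m !))          ≡⟨ ℚP.*-zeroˡ (ℕtoℚ N * ℕtoℚ (m !)) ⟩
      0ℚ                                  ∎))
      where
      Tm 1/m! : ℚ
      Tm = ℕtoℚ (T (fromℕ m))
      1/m! = 1/ℕ (m !) (j!≢0 m)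

    values : (n χ : ℕ) → N ℕ.* χ ≡ ℕΣ.sum (λ j → T j ℕ.* (n C toℕ j)) → ℕtoℚ χ ≡ evalPoly m (coef P) (ℕtoℚ n)
    values n χ Nχ≡sum = begin
      ℕtoℚ χ                                          ≡⟨ ℚP.*-identityˡ (ℕtoℚ χ) ⟨
      1ℚ * ℕtoℚ χ                                     ≡⟨ cong (_* ℕtoℚ χ) (1/ℕ-inverse N N≢0) ⟨
      (1/N * ℕtoℚ N) * ℕtoℚ χ                         ≡⟨ ℚP.*-assoc 1/N (ℕtoℚ N) (ℕtoℚ χ) ⟩
      1/N * (ℕtoℚ N * ℕtoℚ χ)                         ≡⟨ cong (1/N *_) (ℕtoℚ-* N χ) ⟨
      1/N * ℕtoℚ (N ℕ.* χ)                            ≡⟨ cong (λ k → 1/N * ℕtoℚ k) Nχ≡sum ⟩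
      1/N * ℕtoℚ (ℕΣ.sum (λ j → T j ℕ.* (n C toℕ j))) ≡⟨ cong (1/N *_) (ℕtoℚ-sum (λ j → T j ℕ.* (n C toℕ j))) ⟩
      1/N * ℚΣ.sum (λ j → ℕtoℚ (T j ℕ.* (n C toℕ j))) ≡⟨ ℚΣ.*-distribˡ-sum 1/N (λ j → ℕtoℚ (T j ℕ.* (n C toℕ j))) ⟩
      ℚΣ.sum (λ j → 1/N * ℕtoℚ (T j ℕ.* (n C toℕ j))) ≡⟨ ℚΣ.sum-cong-≗ term ⟩
      ℚΣ.sum (λ j → w j * binomial (toℕ j) (ℕtoℚ n))  ≡⟨ eval P (ℕtoℚ n) ⟩
      evalPoly m (coef P) (ℕtoℚ n)                    ∎
      where
      term : ∀ j → 1/N * ℕtoℚ (T j ℕ.* (n C toℕ j)) ≡ w j * binomial (toℕ j) (ℕtoℚ n)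
      term j = begin
        1/N * ℕtoℚ (T j ℕ.* (n C toℕ j))             ≡⟨ cong (1/N *_) (ℕtoℚ-* (T j) (n C toℕ j)) ⟩
        1/N * (ℕtoℚ (T j) * ℕtoℚ (n C toℕ j))        ≡⟨ ℚP.*-assoc 1/N (ℕtoℚ (T j)) _ ⟨
        w j * ℕtoℚ (n C toℕ j)                       ≡⟨ cong (w j *_) (binomial-at-ℕ n (toℕ j)) ⟨
        w j * binomial (toℕ j) (ℕtoℚ n)              ∎

module Colourings {G : Group 0ℓ 0ℓ} {Γ : Graph} (A : Action G Γ) where

  open import Data.Nat as ℕ using (zero; s≤s)
  open import Data.Nat.Combinatorics using (_C_)
  open import Data.Bool as Bool using (Bool; true; false; _∧_)
  import Data.Bool.Properties as BoolP
  open import Data.Fin as F using (toℕ; _<_)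
  import Data.Fin.Properties as FP
  open import Data.Product using (∃; _,_; proj₁; proj₂)
  open import Data.Product.Relation.Binary.Pointwise.NonDependent using () renaming (Pointwise to ×-Pointwise)
  open import Data.Sum using (_⊎_; inj₁; inj₂)
  open import Data.Empty using (⊥-elim)
  open import Relation.Nullary using (Dec; does)
  open import Relation.Nullary.Decidable using (_×-dec_; _→-dec_; ¬?; dec-true; dec-false; decidable-stable)
  open import Relation.Nullary.Negation using (contradiction)
  open import Relation.Binary using (tri<; tri≈; tri>)
  open import Relation.Binary.PropositionalEquality using (refl; cong; cong₂; subst; subst₂)
  import Relation.Binary.PropositionalEquality as ≡
  open Group G renaming (refl to ≈-refl)
  open import Algebra.Properties.Group G using (ε⁻¹≈ε; ⁻¹-anti-homo-∙)
  open Graph Γ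
  open Action A
  open Counting
  open Card
  open IncreasingMaps
  import Data.Nat.Properties as ℕP

  act-inverseˡ : ∀ g v → act (g ⁻¹) (act g v) ≡ v
  act-inverseˡ g v = ≡.trans (≡.sym (act-∙ (g ⁻¹) g v)) (≡.trans (act-resp _ _ (inverseˡ g) v) (act-ε v))

  act-inverseʳ : ∀ g v → act g (act (g ⁻¹) v) ≡ v
  act-inverseʳ g v = ≡.trans (≡.sym (act-∙ g (g ⁻¹) v)) (≡.trans (act-resp _ _ (inverseʳ g) v) (act-ε v))

  act-ε⁻¹ : ∀ v → act (ε ⁻¹) v ≡ v
  act-ε⁻¹ v = ≡.trans (act-resp _ _ ε⁻¹≈ε v) (act-ε v)

  act-∙⁻¹ : ∀ g h v → act ((g ∙ h) ⁻¹) v ≡ act (h ⁻¹) (act (g ⁻¹) v)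
  act-∙⁻¹ g h v = ≡.trans (act-resp _ _ (⁻¹-anti-homo-∙ g h) v) (act-∙ _ _ v)

  -- automorphisms also reflect adjacency, since their inverses preserve it
  act-adj⁻ : ∀ g u v → adj (act g u) (act g v) ≡ true → adj u v ≡ true
  act-adj⁻ g u v guv = subst (λ (x , y) → adj x y ≡ true)
    (cong₂ _,_ (act-inverseˡ g u) (act-inverseˡ g v)) (act-adj (g ⁻¹) _ _ guv)

  adj-invariant : ∀ g u v → adj (act g u) (act g v) ≡ adj u v
  adj-invariant g u v with adj u v in uv
  ... | true = act-adj g u v uv
  ... | false with adj (act g u) (act g v) in guv
  ...   | false = refl
  ...   | true with () ← ≡.trans (≡.sym uv) (act-adj⁻ g u v guv)

  Proper? : ∀ {n} (c : Coloring A n) → Dec (Proper A c)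
  Proper? c = FP.all? λ u → FP.all? λ v → (adj u v Bool.≟ true) →-dec ¬? (c u FP.≟ c v)

  Proper-resp : ∀ {n} {c d : Coloring A n} → c ≗ d → Proper A c → Proper A d
  Proper-resp c≗d c-proper u v uv cu≡cv = c-proper u v uv (≡.trans (c≗d u) (≡.trans cu≡cv (≡.sym (c≗d v))))

  _·_ : ∀ {n} → Carrier → Col A n → Col A n
  g · (c , c-proper) = _·ᶜ_ A g c , λ u v uv → c-proper _ _ (≡.trans (adj-invariant (g ⁻¹) u v) uv)

  _≈ᶜ_ : ∀ {n} → Rel (Col A n) 0ℓ
  (c , _) ≈ᶜ (d , _) = c ≗ d

  ≈ᶜ-equiv : ∀ {n} → IsEquivalence (_≈ᶜ_ {n})
  ≈ᶜ-equiv = record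
    { refl = λ v → refl ; sym = λ p v → ≡.sym (p v) ; trans = λ p q v → ≡.trans (p v) (q v) }

  module Orbits (n : ℕ) = OrbitCounting G (_≈ᶜ_ {n}) ≈ᶜ-equiv _·_
    (λ {g} {h} {c} g≈h c≗d v → ≡.trans (cong (proj₁ c) (act-resp _ _ (⁻¹-cong g≈h) v)) (c≗d _))
    (λ c v → cong (proj₁ c) (act-ε⁻¹ v))
    (λ g h c v → cong (proj₁ c) (act-∙⁻¹ g h v))

  _≈ᶜ?_ : ∀ {n} → Relation.Binary.Decidable (_≈ᶜ_ {n})
  (c , _) ≈ᶜ? (d , _) = FP.all? λ v → c v FP.≟ d v

  _<ᵇ_ : ∀ {n} → Fin n → Fin n → Bool
  x <ᵇ y = does (x FP.<? y)

  <ᵇ-sound : ∀ {n} {x y : Fin n} → x <ᵇ y ≡ true → x < y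
  <ᵇ-sound {x = x} {y} e = decidable-stable (x FP.<? y) λ x≮y →
    contradiction (≡.trans (≡.sym e) (dec-false (x FP.<? y) x≮y)) λ ()

  <ᵇ-complete : ∀ {n} {x y : Fin n} → x < y → x <ᵇ y ≡ true
  <ᵇ-complete {x = x} {y} = dec-true (x FP.<? y)

  <ᵇ-false : ∀ {n} {x y : Fin n} → y < x → x <ᵇ y ≡ false
  <ᵇ-false {x = x} {y} y<x = dec-false (x FP.<? y) (FP.<-asym y<x)

  ∧-left : ∀ {a b} → a ∧ b ≡ true → a ≡ true
  ∧-left {true} _ = refl

  ∧-right : ∀ {a b} → a ∧ b ≡ true → b ≡ true
  ∧-right {true} e = e

  module _ {n : ℕ} (c : Coloring A n) (c-proper : Proper A c) where

    orientation : Orientation A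
    orientation = record
      { arc      = λ u v → adj u v ∧ (c u <ᵇ c v)
      ; arc-edge = λ u v → ∧-left
      ; arc-tot  = total
      ; arc-asym = λ u v e → ≡.trans (cong (adj v u ∧_) (<ᵇ-false {x = c v} (<ᵇ-sound {x = c u} (∧-right {adj u v} e))))
                                     (BoolP.∧-zeroʳ (adj v u))
      }
      where
      -- a proper colouring distinguishes the endpoints of an edge
      total : ∀ u v → adj u v ≡ true → adj u v ∧ (c u <ᵇ c v) ≡ true ⊎ adj v u ∧ (c v <ᵇ c u) ≡ true
      total u v uv with FP.<-cmp (c u) (c v)
      ... | tri< cu<cv _ _ = inj₁ (cong₂ _∧_ uv (<ᵇ-complete cu<cv))
      ... | tri≈ _ cu≡cv _ = ⊥-elim (c-proper u v uv cu≡cv)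
      ... | tri> _ _ cv<cu = inj₂ (cong₂ _∧_ (≡.trans (adj-sym v u) uv) (<ᵇ-complete cv<cu))

    -- colours strictly increase along directed paths, so the orientation is acyclic
    path-increasing : ∀ {u w} → Path A orientation u w → c u < c w
    path-increasing {u} {w} (edge e) = <ᵇ-sound (∧-right {adj u w} e)
    path-increasing {u} (cons {v = v} e q) = FP.<-trans (<ᵇ-sound (∧-right {adj u v} e)) (path-increasing q)

  module _ {n : ℕ} where
    open Orbits n using (FixedPair; _≈ᶠ_; _,_)

    fixed-constant : ∀ {g} {c : Coloring A n} → (∀ v → (_·ᶜ_ A g c) v ≡ c v) →
      ∀ k x → c (iter A (act g) k x) ≡ c x
    fixed-constant         fixed zero    x = refl
    fixed-constant {g} {c} fixed (suc k) x =
      ≡.trans (≡.trans (≡.sym (fixed _)) (cong c (act-inverseˡ g _))) (fixed-constant fixed k x)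

    toTriple : FixedPair → Triple A n
    toTriple (g , (c , c-proper) , fixed) =
      g , orientation c c-proper , acyclic , invariant , c , constant , monotone
      where
      acyclic : Acyclic A (orientation c c-proper)
      acyclic v cycle = FP.<-irrefl refl (path-increasing c c-proper cycle)
      invariant : Fixed A g (orientation c c-proper)
      invariant u v = cong₂ _∧_ (adj-invariant (g ⁻¹) u v) (cong₂ _<ᵇ_ (fixed u) (fixed v))
      constant : ∀ x → c (act g x) ≡ c x
      constant = fixed-constant fixed 1
      monotone : ∀ x y → QLess A g (orientation c c-proper) x y → c x < c y
      monotone x y (x̃ , ỹ , (k , x̃≡) , (l , ỹ≡) , path) =
        subst₂ _<_ (≡.trans (cong c x̃≡) (fixed-constant fixed k x)) (≡.trans (cong c ỹ≡) (fixed-constant fixed l y))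
               (path-increasing c c-proper path)

    edge-less : ∀ {g σ u v} → arc σ u v ≡ true → QLess A g σ u v
    edge-less e = _ , _ , (0 , refl) , (0 , refl) , edge e

    -- conversely φ is a proper colouring (it separates the ends of each
    -- arc) and is fixed by g (it is constant on ⟨g⟩-orbits)
    fromTriple : Triple A n → FixedPair
    fromTriple (g , σ , _ , _ , φ , constant , monotone) = g , (φ , φ-proper) , φ-fixed
      where
      φ-proper : Proper A φ
      φ-proper u v uv φu≡φv with arc-tot σ u v uv
      ... | inj₁ e = FP.<⇒≢ (monotone u v (edge-less e)) φu≡φv
      ... | inj₂ e = FP.<⇒≢ (monotone v u (edge-less e)) (≡.sym φu≡φv)
      φ-fixed : ∀ v → φ (act (g ⁻¹) v) ≡ φ v
      φ-fixed v = ≡.trans (≡.sym (constant (act (g ⁻¹) v))) (cong φ (act-inverseʳ g v))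

    ≈ᵗ-trans : ∀ {x y z : Triple A n} → _≈ᵗ_ A x y → _≈ᵗ_ A y z → _≈ᵗ_ A x z
    ≈ᵗ-trans (p , q , r) (p' , q' , r') =
      Group.trans G p p' , (λ u v → ≡.trans (q u v) (q' u v)) , λ x → ≡.trans (r x) (r' x)

    -- toTriple is a bijection up to the equivalences: fromTriple is a
    -- section, since an acyclic σ is recovered from any strictly monotone φ
    Card-Triple : ∀ {k} → Card FixedPair _≈ᶠ_ k → TripleCount A n k
    Card-Triple = Card-map (λ {x} {y} {z} → ≈ᵗ-trans {x} {y} {z}) toTriple
      (λ { {a , (c , _) , _} {_ , (d , _) , _} (a≈ , c≗d) →
             a≈ , (λ u v → cong (adj u v ∧_) (cong₂ _<ᵇ_ (c≗d u) (c≗d v))) , c≗d })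
      (λ _ _ (a≈ , _ , c≗d) → a≈ , c≗d)
      (λ t → fromTriple t , ≈-refl , arcs-agree t , λ x → refl)
      where
      arcs-agree : ∀ t → let (_ , σ , _ , _ , φ , _) = t in
        ∀ u v → adj u v ∧ (φ u <ᵇ φ v) ≡ arc σ u v
      arcs-agree (g , σ , _ , _ , φ , _ , monotone) u v with arc σ u v in e
      ... | true = cong₂ _∧_ (arc-edge σ u v e) (<ᵇ-complete (monotone u v (edge-less e)))
      ... | false with adj u v in uv
      ...   | false = refl
      ...   | true with arc-tot σ u v uv
      ...     | inj₁ e' with () ← ≡.trans (≡.sym e) e'
      ...     | inj₂ e' = <ᵇ-false (monotone v u (edge-less e'))

  Invariant : ∀ {k} → Carrier → (Fin m → Fin k) → Set
  Invariant g s = ∀ v → s (act (g ⁻¹) v) ≡ s v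

  IsExact : Carrier → (k : ℕ) → (Fin m → Fin k) → Set
  IsExact g k s = (∀ i → ∃ λ v → s v ≡ i) × Proper A s × Invariant g s

  Exact : Carrier → ℕ → Set
  Exact g k = Σ (Fin m → Fin k) (IsExact g k)

  _≗ₑ_ : ∀ {g k} → Rel (Exact g k) 0ℓ
  e ≗ₑ e' = proj₁ e ≗ proj₁ e'

  Card-Exact : ∀ g k → ∃ (Card (Exact g k) _≗ₑ_)
  Card-Exact g k = Card-subset (IsExact g k) IsExact? IsExact-resp _≗ₑ_
    (record { refl = λ v → refl ; sym = λ p v → ≡.sym (p v) ; trans = λ p q v → ≡.trans (p v) (q v) })
    (λ e e' → FP.all? λ v → proj₁ e v FP.≟ proj₁ e' v) (λ s≗s' → s≗s')
    where
    IsExact? : ∀ s → Dec (IsExact g k s)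
    IsExact? s = FP.all? (λ i → FP.any? λ v → s v FP.≟ i)
           ×-dec (Proper? s ×-dec FP.all? λ v → s (act (g ⁻¹) v) FP.≟ s v)
    IsExact-resp : ∀ {s s'} → s ≗ s' → IsExact g k s → IsExact g k s'
    IsExact-resp s≗s' (onto , s-proper , s-invariant) =
      (λ i → let (v , sv≡i) = onto i in v , ≡.trans (≡.sym (s≗s' v)) sv≡i) ,
      Proper-resp s≗s' s-proper ,
      λ v → ≡.trans (≡.sym (s≗s' _)) (≡.trans (s-invariant v) (s≗s' v))

  identity-exact : ∀ {g} → g ≈ ε → Exact g m
  identity-exact g≈ε = (λ v → v) , (λ i → i , refl) , identity-proper ,
    λ v → ≡.trans (act-resp _ _ (⁻¹-cong g≈ε) v) (act-ε⁻¹ v)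
    where
    identity-proper : Proper A (λ v → v)
    identity-proper u v uv refl with () ← ≡.trans (≡.sym (loopless u)) uv

  module Factorised (g : Carrier) (n : ℕ) where

    Piece : Fin (suc m) → Set
    Piece j = Exact g (toℕ j) × Inc (toℕ j) n

    _≈ₚ_ : ∀ {j} → Rel (Piece j) 0ℓ
    _≈ₚ_ = ×-Pointwise _≗ₑ_ _≗ᵢ_

    pieces-equiv : ∀ {j} → IsEquivalence (_≈ₚ_ {j})
    pieces-equiv = record
      { refl  = (λ v → refl) , (λ i → refl)
      ; sym   = λ (p , q) → (λ v → ≡.sym (p v)) , (λ i → ≡.sym (q i))
      ; trans = λ (p , q) (p' , q') → (λ v → ≡.trans (p v) (p' v)) , (λ i → ≡.trans (q i) (q' i)) }

    composite : ∀ {k} → Exact g k × Inc k n → Fin m → Fin n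
    composite ((s , _) , (h , _)) = h ∘ s

    compose : Σ (Fin (suc m)) Piece → Σ (Col A n) (Orbits.Fixes n g)
    compose (j , (s , _ , s-proper , s-invariant) , (h , h-inc)) =
      (h ∘ s , λ u v uv hsu≡hsv → s-proper u v uv (increasing-injective h-inc _ _ hsu≡hsv)) ,
      λ v → cong h (s-invariant v)

    compose-resp : ∀ {a b : Σ (Fin (suc m)) Piece} → FibreRel (λ j → _≈ₚ_ {j}) a b → proj₁ (compose a) ≈ᶜ proj₁ (compose b)
    compose-resp {_ , ((s , _) , (h , _))} {_ , ((s' , _) , _)} (same-fibre (s≗s' , h≗h')) v =
      ≡.trans (cong h (s≗s' v)) (h≗h' (s' v))

    -- equal composites come from the same piece, by uniqueness of the
    -- increasing enumeration of their common image
    compose-refl : ∀ (a b : Σ (Fin (suc m)) Piece) → proj₁ (compose a) ≈ᶜ proj₁ (compose b) → FibreRel (λ j → _≈ₚ_ {j}) a b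
    compose-refl (j , x@((s , onto , _) , (h , h-inc))) (j' , x'@((s' , onto' , _) , (h' , h'-inc))) hs≗h's' =
      same-piece j j' x x' (FP.toℕ-injective (proj₁ same-image)) hs≗h's' (proj₂ same-image)
      where
      same-image : toℕ j ≡ toℕ j' × (∀ i i' → toℕ i ≡ toℕ i' → h i ≡ h' i')
      same-image = increasing-unique h h' h-inc h'-inc
        (λ i → let (v , sv≡i) = onto i in s' v , ≡.trans (cong h (≡.sym sv≡i)) (hs≗h's' v))
        (λ i → let (v , s'v≡i) = onto' i in s v , ≡.trans (cong h' (≡.sym s'v≡i)) (≡.sym (hs≗h's' v)))
      same-piece : ∀ j j' (x : Piece j) (x' : Piece j') → j ≡ j' → composite x ≗ composite x' →
        (∀ i i' → toℕ i ≡ toℕ i' → proj₁ (proj₂ x) i ≡ proj₁ (proj₂ x') i') →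
        FibreRel (λ j → _≈ₚ_ {j}) (j , x) (j' , x')
      same-piece j .j ((s , _) , (h , h-inc)) ((s' , _) , (h' , _)) refl hs≗h's' h≡h' = same-fibre
        ((λ v → increasing-injective h-inc _ _ (≡.trans (hs≗h's' v) (≡.sym (h≡h' (s' v) (s' v) refl)))) ,
         (λ i → h≡h' i i refl))

    piece : ∀ {k} (j : Fin (suc m)) → toℕ j ≡ k → Exact g k × Inc k n → Σ (Fin (suc m)) Piece
    piece j refl x = j , x

    compose-piece : ∀ {k} j (eq : toℕ j ≡ k) x → proj₁ (proj₁ (compose (piece j eq x))) ≗ composite x
    compose-piece j refl x v = refl

    compose-surj : ∀ (b : Σ (Col A n) (Orbits.Fixes n g)) → ∃ λ a → proj₁ (compose a) ≈ᶜ proj₁ b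
    compose-surj ((c , c-proper) , c-fixed) =
      piece (F.fromℕ< (s≤s k≤m)) (FP.toℕ-fromℕ< (s≤s k≤m)) x ,
      λ v → ≡.trans (compose-piece _ (FP.toℕ-fromℕ< (s≤s k≤m)) x v) (factors v)
      where
      open Factorisation (image-factorisation c)
      inclusion-injective : ∀ i j → inclusion i ≡ inclusion j → i ≡ j
      inclusion-injective = increasing-injective inclusion-inc
      x : Exact g k × Inc k n
      x = (surjection , onto ,
           (λ u v uv su≡sv → c-proper u v uv (≡.trans (≡.sym (factors u)) (≡.trans (cong inclusion su≡sv) (factors v)))) ,
           (λ v → inclusion-injective _ _ (≡.trans (factors _) (≡.trans (c-fixed v) (≡.sym (factors v)))))) ,
          (inclusion , inclusion-inc)

  Card-fixed : ∀ g n {E : ℕ → ℕ} → (∀ k → Card (Exact g k) _≗ₑ_ (E k)) →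
    Card (Σ (Col A n) (Orbits.Fixes n g)) (λ a b → proj₁ a ≈ᶜ proj₁ b)
         (ℕΣ.sum (λ (j : Fin (suc m)) → E (toℕ j) ℕ.* (n C toℕ j)))
  Card-fixed g n CE =
    Card-map (λ {a} {b} {c} p q v → ≡.trans (p v) (q v)) compose compose-resp compose-refl compose-surj
      (Card-Σ (λ _ → pieces-equiv) (λ j → Card-× (CE (toℕ j)) (Card-Inc (toℕ j) n)))
    where open Factorised g n

  module _ {oG : ℕ} (CG : Card Carrier _≈_ oG) where

    open Card CG using () renaming (enum to elementG)

    orbitCount : ∀ n → ∃ (OrbitCount A n)
    orbitCount n = Card-subset (Proper A) Proper? Proper-resp (SameOrbit A) SameOrbitₓ-equiv
      (sameOrbit? _≈ᶜ?_) (λ {f} {g} {p} {q} f≗g → ε , λ v → ≡.trans (cong f (act-ε⁻¹ v)) (f≗g v))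
      where open Orbits n
            open Finite CG

    exactTotal : ℕ → ℕ
    exactTotal k = ℕΣ.sum λ i → proj₁ (Card-Exact (elementG i) k)

    orbit-binomial-expansion : ∀ n {χ} → OrbitCount A n χ →
      oG ℕ.* χ ≡ ℕΣ.sum (λ (j : Fin (suc m)) → exactTotal (toℕ j) ℕ.* (n C toℕ j))
    orbit-binomial-expansion n {χ} CO = begin
      oG ℕ.* χ
        ≡⟨ burnside _≈ᶜ?_ CO (λ i → Card-fixed (elementG i) n (proj₂ ∘ Card-Exact (elementG i))) ⟩
      ℕΣ.sum (λ i → ℕΣ.sum (λ j → E i j ℕ.* (n C toℕ j)))
        ≡⟨ ℕΣ.∑-comm (λ i j → E i j ℕ.* (n C toℕ j)) ⟩
      ℕΣ.sum (λ j → ℕΣ.sum (λ i → E i j ℕ.* (n C toℕ j)))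
        ≡⟨ ℕΣ.sum-cong-≗ (λ j → ≡.sym (ℕΣ.*-distribʳ-sum (n C toℕ j) (λ i → E i j))) ⟩
      ℕΣ.sum (λ (j : Fin (suc m)) → exactTotal (toℕ j) ℕ.* (n C toℕ j)) ∎
      where
      open Orbits n
      open Finite CG
      open ≡.≡-Reasoning
      E : Fin oG → Fin (suc m) → ℕ
      E i j = proj₁ (Card-Exact (elementG i) (toℕ j))

    -- the identity colouring is exact for the element representing ε
    exactTotal-top≢0 : exactTotal m ≢ 0
    exactTotal-top≢0 total≡0 = Card-nonzero (proj₂ (Card-Exact (elementG i₀) m))
      (identity-exact (proj₂ (surj CG ε)))
      (ℕP.n≤0⇒n≡0 (≡.subst (proj₁ (Card-Exact (elementG i₀) m) ℕ.≤_) total≡0 (≤-sum _ i₀)))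
      where i₀ : Fin oG
            i₀ = proj₁ (surj CG ε)

open import Data.Nat using (_≤_; _*_)

mainTheorem4 : (G : Group 0ℓ 0ℓ) (Γ : Graph) (A : Action G Γ)
    (orderG : ℕ) → Card (Group.Carrier G) (Group._≈_ G) orderG →
    ((n : ℕ) → 1 ≤ n →
    Σ ℕ λ χ → OrbitCount A n χ × TripleCount A n (orderG * χ))
    × (Σ (Fin (suc ∣ Γ ∣ᵥ) → ℚ) λ a →
    (a (fromℕ ∣ Γ ∣ᵥ) ≢ 0ℚ) ×
    ((n : ℕ) → 1 ≤ n → (χ : ℕ) → OrbitCount A n χ →
    ℕtoℚ χ ≡ evalPoly ∣ Γ ∣ᵥ a (ℕtoℚ n)))
mainTheorem4 G Γ A orderG CG = orbits-and-triples , polynomial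
  where
  open Colourings A
  open import Data.Product using (_,_)
  open import Data.Fin using (toℕ)
  open import Data.Fin.Properties using (toℕ-fromℕ)
  import Relation.Binary.PropositionalEquality as ≡

  -- χ orbits of colourings give |G|·χ fixed pairs (g, c), and these are
  -- the triples (g, σ, φ) by Stanley's correspondence
  orbits-and-triples : (n : ℕ) → 1 ≤ n → Σ ℕ λ χ → OrbitCount A n χ × TripleCount A n (orderG * χ)
  orbits-and-triples n _ = let (χ , CO) = orbitCount CG n in
    χ , CO , Card-Triple (Orbits.Finite.Card-FixedPair n CG _≈ᶜ?_ CO)

  orderG≢0 : orderG ≢ 0
  orderG≢0 = Counting.Card-nonzero CG (Group.ε G)

  top≢0 : exactTotal CG (toℕ (fromℕ ∣ Γ ∣ᵥ)) ≢ 0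
  top≢0 = ≡.subst (λ k → exactTotal CG k ≢ 0) (≡.sym (toℕ-fromℕ ∣ Γ ∣ᵥ)) (exactTotal-top≢0 CG)

  polynomial : Σ (Fin (suc ∣ Γ ∣ᵥ) → ℚ) λ a → (a (fromℕ ∣ Γ ∣ᵥ) ≢ 0ℚ) ×
    ((n : ℕ) → 1 ≤ n → (χ : ℕ) → OrbitCount A n χ → ℕtoℚ χ ≡ evalPoly ∣ Γ ∣ᵥ a (ℕtoℚ n))
  polynomial =
    let (a , a-top≢0 , values) = BinomialPolynomials.binomial-expansion-poly orderG orderG≢0 ∣ Γ ∣ᵥ (exactTotal CG ∘ toℕ) top≢0
    in a , a-top≢0 , λ n _ χ CO → values n χ (orbit-binomial-expansion CG n CO)
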